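{- Every finite simple cubic claw-free graph with fewer than $114$ vertices contains a cycle whose length is a power of $2$. Equivalently, any cubic claw-free counterexample to the Erd\H{o}s-Gy\'{a}rf\'{a}s conjecture must have at least $114$ vertices.
   Context: A graph is cubic if every vertex has degree $3$, and claw-free if it does not contain $K_{1,3}$ as an induced subgraph. The Erd\H{o}s-Gy\'{a}rf\'{a}s conjecture states that every graph with minimum degree at least three has a cycle whose length is a power of $2$. -}

module Defs where

open import Data.Nat using (ℕ; suc; _^_; _<_; _≤_)
open import Data.Fin using (Fin; zero; suc; toℕ)
open import Data.Bool using (Bool; true; false)
open import Data.Product using (Σ; ∃; _×_; _,_)
open import Data.Sum using (_⊎_)
open import Relation.Binary.PropositionalEquality using (_≡_; _≢_)
open import Relation.Nullary using (¬_)
open import Function.Definitions using (Injective)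

record Graph (n : ℕ) : Set where
  field
    adj   : Fin n → Fin n → Bool
    sym   : ∀ u v → adj u v ≡ adj v u
    irrfl : ∀ v → adj v v ≡ false

open Graph public

Adj : ∀ {n} → Graph n → Fin n → Fin n → Set
Adj G u v = adj G u v ≡ true

Degree3 : ∀ {n} → Graph n → Fin n → Set
Degree3 G v = Σ (Fin _) λ a → Σ (Fin _) λ b → Σ (Fin _) λ c →
  (a ≢ b) × (a ≢ c) × (b ≢ c) ×
  Adj G v a × Adj G v b × Adj G v c ×
  (∀ w → Adj G v w → (w ≡ a) ⊎ (w ≡ b) ⊎ (w ≡ c))

Cubic : ∀ {n} → Graph n → Set
Cubic G = ∀ v → Degree3 G v

HasInducedClaw : ∀ {n} → Graph n → Set
HasInducedClaw {n} G = Σ (Fin n) λ v → Σ (Fin n) λ a → Σ (Fin n) λ b → Σ (Fin n) λ c →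
  Adj G v a × Adj G v b × Adj G v c ×
  ¬ Adj G a b × ¬ Adj G a c × ¬ Adj G b c ×
  (a ≢ b) × (a ≢ c) × (b ≢ c)

ClawFree : ∀ {n} → Graph n → Set
ClawFree G = ¬ HasInducedClaw G

next : ∀ {k} → Fin k → Fin k
next {suc k} i with Data.Nat._≟_ (suc (toℕ i)) (suc k)
... | Relation.Nullary.yes _ = zero
... | Relation.Nullary.no ¬p = Data.Fin.fromℕ< (Data.Nat.Properties.≤∧≢⇒< (Data.Fin.Properties.toℕ<n i) ¬p)
  where import Data.Fin.Properties
        import Data.Nat.Properties

HasCycleOfLength : ∀ {n} → Graph n → ℕ → Set
HasCycleOfLength {n} G k = 3 ≤ k × Σ (Fin k → Fin n) λ x →
  Injective _≡_ _≡_ x × (∀ i → Adj G (x i) (x (next i)))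

IsPowerOf2 : ℕ → Set
IsPowerOf2 k = ∃ λ m → k ≡ 2 ^ m

module Submission where

-- 1. The three neighbours of a vertex span at least one edge (no claw). If they span two
--    edges, G has a 4-cycle. Otherwise every vertex v lies in exactly one triangle
--    {v, p v, q v}, and its third neighbour o v lies outside it; o is an involution.
-- 2. Contracting the triangles gives a cubic triangle graph. A cycle of length L in it lifts
--    to cycles of G of every length 2L + k with 0 ≤ k ≤ L (a cycle may pass through one or
--    two vertices of each triangle besides its entry). For L ∈ {2,3,4,6,7,8} one of these
--    lengths is 4, 8 or 16; L = 1 is impossible.
-- 3. A level-by-level search of the ball of radius 4 around one triangle either meets a
--    triangle cycle of length ≤ 8 or finds 46 distinct triangles, i.e. 138 > n vertices.
-- 4. Only a 5-cycle C remains. Searching the ball of radius 3 around C either finds 40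
--    distinct triangles (120 > n vertices) or a clash; a clash closes two cycles going round
--    the two sides of C, and a length table shows that one of them lifts.

open import Defs
open import Data.Nat as ℕ using (ℕ; zero; suc; _+_; _*_; _∸_; _<_; _≤_; z≤n; s≤s)
import Data.Nat.Properties as NP
open import Data.Nat.Tactic.RingSolver using (solve-∀)
open import Data.Fin as F using (Fin; toℕ)
import Data.Fin.Properties as FP
open import Data.Bool using (Bool; true; false)
import Data.Bool as B
open import Data.Product using (Σ; ∃; _×_; _,_; proj₁; proj₂)
open import Data.Sum using (_⊎_; inj₁; inj₂)
import Data.Sum as Sum
open import Data.Empty using (⊥; ⊥-elim)
open import Data.Unit using (tt)
open import Data.List using (List; []; _∷_; _++_; length; [_]; map; take; concatMap; allFin; cartesianProductWith; lookup; initLast; _∷ʳ′_)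
import Data.List.Properties as LP
open import Data.List.Relation.Unary.All as All using (All; []; _∷_)
open import Data.List.Relation.Unary.Any using (here; there; any?)
open import Data.List.Relation.Unary.AllPairs using (AllPairs; []; _∷_; allPairs?) renaming (map to allPairs-map)
import Data.List.Relation.Unary.AllPairs.Properties as AP
import Data.List.Relation.Unary.All.Properties as AllP
open import Data.List.Relation.Unary.Linked using (Linked; []; [-]; _∷_)
open import Data.List.Relation.Binary.Pointwise as PW using (Pointwise; []; _∷_)
open import Data.List.Membership.Propositional using (_∈_; find; lose)
open import Data.List.Membership.Propositional.Properties
  using (∈-++⁻; ∈-++⁺ˡ; ∈-++⁺ʳ; ∈-map⁺; ∈-map⁻; ∈-allFin; ∈-lookup; ∈-cartesianProductWith⁺; ∈-cartesianProductWith⁻)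
open import Relation.Binary.PropositionalEquality as Eq using (_≡_; _≢_; refl; cong; cong₂; subst; subst₂; trans)
open import Relation.Binary.Definitions using (DecidableEquality; tri<; tri≈; tri>)
open import Relation.Nullary using (¬_; yes; no; Dec)
open import Relation.Nullary.Decidable using (toWitness; ¬?)

nth : ∀ {A : Set} → A → List A → ℕ → A
nth d [] _ = d
nth d (y ∷ ys) zero = y
nth d (y ∷ ys) (suc i) = nth d ys i

nth-≢-head : ∀ {A : Set} (d y : A) {zs} → All (y ≢_) zs → ∀ j → j < length zs → y ≢ nth d zs j
nth-≢-head d y (y≢z ∷ _) zero _ = y≢z
nth-≢-head d y (_ ∷ y≢zs) (suc j) (s≤s j<) = nth-≢-head d y y≢zs j j<

nth-injective : ∀ {A : Set} (d : A) (ys : List A) → AllPairs _≢_ ys →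
  ∀ i j → i < length ys → j < length ys → nth d ys i ≡ nth d ys j → i ≡ j
nth-injective d (y ∷ ys) (y≢ys ∷ _) zero zero _ _ _ = refl
nth-injective d (y ∷ ys) (y≢ys ∷ _) zero (suc j) _ (s≤s j<) e = ⊥-elim (nth-≢-head d y y≢ys j j< e)
nth-injective d (y ∷ ys) (y≢ys ∷ _) (suc i) zero (s≤s i<) _ e = ⊥-elim (nth-≢-head d y y≢ys i i< (Eq.sym e))
nth-injective d (y ∷ ys) (_ ∷ distinct) (suc i) (suc j) (s≤s i<) (s≤s j<) e =
  cong suc (nth-injective d ys distinct i j i< j< e)

nth-linked : ∀ {A : Set} {R : A → A → Set} (d : A) (zs : List A) → Linked R zs →
  ∀ i → suc i < length zs → R (nth d zs i) (nth d zs (suc i))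
nth-linked d (z ∷ []) [-] zero (s≤s ())
nth-linked d (z ∷ w ∷ zs) (r ∷ rs) zero _ = r
nth-linked d (z ∷ w ∷ zs) (r ∷ rs) (suc i) (s≤s l) = nth-linked d (w ∷ zs) rs i l

nth-snoc : ∀ {A : Set} (d : A) (ys : List A) (x : A) → ∀ i → i < length ys → nth d (ys ++ [ x ]) i ≡ nth d ys i
nth-snoc d (y ∷ ys) x zero _ = refl
nth-snoc d (y ∷ ys) x (suc i) (s≤s l) = nth-snoc d ys x i l

nth-last : ∀ {A : Set} (d : A) (ys : List A) (x : A) → nth d (ys ++ [ x ]) (length ys) ≡ x
nth-last d [] x = refl
nth-last d (y ∷ ys) x = nth-last d ys x

length-snoc : ∀ {A : Set} (ys : List A) (x : A) → length (ys ++ [ x ]) ≡ suc (length ys)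
length-snoc [] x = refl
length-snoc (y ∷ ys) x = cong suc (length-snoc ys x)

next-cases : ∀ {k} (i : Fin (suc k)) → (suc (toℕ i) ≡ suc k × next i ≡ F.zero) ⊎ (toℕ (next i) ≡ suc (toℕ i))
next-cases {k} i with suc (toℕ i) ℕ.≟ suc k
... | yes last = inj₁ (last , refl)
... | no ¬last = inj₂ (FP.toℕ-fromℕ< (NP.≤∧≢⇒< (FP.toℕ<n i) ¬last))

cycleFromList : ∀ {n} (G : Graph n) (x₀ : Fin n) (xs : List (Fin n)) →
  AllPairs _≢_ (x₀ ∷ xs) → Linked (Adj G) ((x₀ ∷ xs) ++ [ x₀ ]) → 2 ≤ length xs →
  HasCycleOfLength G (suc (length xs))
cycleFromList {n} G x₀ xs distinct linked 2≤ = s≤s 2≤ , x , x-injective , x-adjacent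
  where
  ys = x₀ ∷ xs
  closed = ys ++ [ x₀ ]
  x : Fin (suc (length xs)) → Fin n
  x i = nth x₀ ys (toℕ i)
  x-injective : ∀ {i j} → x i ≡ x j → i ≡ j
  x-injective {i} {j} e = FP.toℕ-injective (nth-injective x₀ ys distinct (toℕ i) (toℕ j) (FP.toℕ<n i) (FP.toℕ<n j) e)
  step : ∀ i → suc i < suc (length ys) → Adj G (nth x₀ closed i) (nth x₀ closed (suc i))
  step i l = nth-linked x₀ closed linked i (subst (suc i <_) (Eq.sym (length-snoc ys x₀)) l)
  x-adjacent : ∀ i → Adj G (x i) (x (next i))
  x-adjacent i with next-cases i
  ... | inj₁ (last , wraps) rewrite wraps =
        subst₂ (Adj G) (nth-snoc x₀ ys x₀ (toℕ i) (FP.toℕ<n i))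
          (trans (cong (nth x₀ closed) last) (nth-last x₀ ys x₀))
          (step (toℕ i) (s≤s (subst (_≤ suc (length xs)) (Eq.sym last) NP.≤-refl)))
  ... | inj₂ succ rewrite succ =
        subst₂ (Adj G) (nth-snoc x₀ ys x₀ (toℕ i) (FP.toℕ<n i)) (nth-snoc x₀ ys x₀ (suc (toℕ i)) i+1<)
          (step (toℕ i) (NP.m≤n⇒m≤1+n i+1<))
    where
    i+1< : suc (toℕ i) < length ys
    i+1< = subst (_< length ys) succ (FP.toℕ<n (next i))

module GraphFacts {n : ℕ} (G : Graph n) where

  adj-sym : ∀ {a b} → Adj G a b → Adj G b a
  adj-sym {a} {b} e = trans (Graph.sym G b a) e

  adj⇒≢ : ∀ {a b} → Adj G a b → a ≢ b
  adj⇒≢ {a} e refl with trans (Eq.sym e) (irrfl G a)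
  ... | ()

  adj? : ∀ a b → Dec (Adj G a b)
  adj? a b = adj G a b B.≟ true

  fourCycle : ∀ v a b c → Adj G v a → Adj G v b → Adj G a b → Adj G b c → Adj G c v →
    a ≢ b → a ≢ c → b ≢ c → HasCycleOfLength G 4
  fourCycle v a b c va vb ab bc cv a≢b a≢c b≢c = cycleFromList G v (a ∷ b ∷ c ∷ [])
    ((adj⇒≢ va ∷ adj⇒≢ vb ∷ adj⇒≢ (adj-sym cv) ∷ []) ∷ (a≢b ∷ a≢c ∷ []) ∷ (b≢c ∷ []) ∷ [] ∷ [])
    (va ∷ ab ∷ bc ∷ cv ∷ [-]) (s≤s (s≤s z≤n))

record LocalTriangle {n : ℕ} (G : Graph n) (v : Fin n) : Set where
  field
    p q o : Fin n
    adj-p : Adj G v p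
    adj-q : Adj G v q
    adj-pq : Adj G p q
    adj-o : Adj G v o
    neighbours : ∀ w → Adj G v w → w ≡ p ⊎ w ≡ q ⊎ w ≡ o
    p≢q : p ≢ q
    p≢o : p ≢ o
    q≢o : q ≢ o
    ¬adj-po : ¬ Adj G p o
    ¬adj-qo : ¬ Adj G q o

module _ {n : ℕ} (G : Graph n) where
  open GraphFacts G

  -- The three neighbours of a vertex of a cubic claw-free graph span at least one edge.
  -- Two edges among them close a 4-cycle; exactly one edge gives a local triangle.
  localTriangleOr4Cycle : Cubic G → ClawFree G → ∀ v → HasCycleOfLength G 4 ⊎ LocalTriangle G v
  localTriangleOr4Cycle cubic clawFree v with cubic v
  ... | a , b , c , a≢b , a≢c , b≢c , va , vb , vc , nbrs with adj? a b | adj? a c | adj? b c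
  ... | yes ab | yes ac | _ = inj₁ (fourCycle v b a c vb va (adj-sym ab) ac (adj-sym vc) (λ e → a≢b (Eq.sym e)) b≢c a≢c)
  ... | yes ab | no _ | yes bc = inj₁ (fourCycle v a b c va vb ab bc (adj-sym vc) a≢b a≢c b≢c)
  ... | no _ | yes ac | yes bc = inj₁ (fourCycle v a c b va vc ac (adj-sym bc) (adj-sym vb) a≢c a≢b (λ e → b≢c (Eq.sym e)))
  ... | no ¬ab | no ¬ac | no ¬bc = ⊥-elim (clawFree (v , a , b , c , va , vb , vc , ¬ab , ¬ac , ¬bc , a≢b , a≢c , b≢c))
  ... | yes ab | no ¬ac | no ¬bc = inj₂ (record
    { p = a ; q = b ; o = c ; adj-p = va ; adj-q = vb ; adj-pq = ab ; adj-o = vc ; neighbours = nbrs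
    ; p≢q = a≢b ; p≢o = a≢c ; q≢o = b≢c ; ¬adj-po = ¬ac ; ¬adj-qo = ¬bc })
  ... | no ¬ab | yes ac | no ¬bc = inj₂ (record
    { p = a ; q = c ; o = b ; adj-p = va ; adj-q = vc ; adj-pq = ac ; adj-o = vb
    ; neighbours = λ w vw → Sum.map₂ Sum.swap (nbrs w vw)
    ; p≢q = a≢c ; p≢o = a≢b ; q≢o = λ e → b≢c (Eq.sym e) ; ¬adj-po = ¬ab ; ¬adj-qo = λ cb → ¬bc (adj-sym cb) })
  ... | no ¬ab | no ¬ac | yes bc = inj₂ (record
    { p = b ; q = c ; o = a ; adj-p = vb ; adj-q = vc ; adj-pq = bc ; adj-o = va
    ; neighbours = λ w vw → rotate (nbrs w vw)
    ; p≢q = b≢c ; p≢o = λ e → a≢b (Eq.sym e) ; q≢o = λ e → a≢c (Eq.sym e)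
    ; ¬adj-po = λ ba → ¬ab (adj-sym ba) ; ¬adj-qo = λ ca → ¬ac (adj-sym ca) })
    where
    rotate : ∀ {w} → w ≡ a ⊎ w ≡ b ⊎ w ≡ c → w ≡ b ⊎ w ≡ c ⊎ w ≡ a
    rotate (inj₁ e) = inj₂ (inj₂ e)
    rotate (inj₂ (inj₁ e)) = inj₁ e
    rotate (inj₂ (inj₂ e)) = inj₂ (inj₁ e)

someOrAll : ∀ {n} {A : Set} {B : Fin n → Set} → (∀ v → A ⊎ B v) → A ⊎ (∀ v → B v)
someOrAll {zero} h = inj₂ λ ()
someOrAll {suc n} h with h F.zero | someOrAll (λ v → h (F.suc v))
... | inj₁ a | _ = inj₁ a
... | inj₂ _ | inj₁ a = inj₁ a
... | inj₂ b₀ | inj₂ bs = inj₂ λ { F.zero → b₀ ; (F.suc v) → bs v }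

record TriangleStructure {n : ℕ} (G : Graph n) : Set where
  field
    p q o : Fin n → Fin n
    adj-p : ∀ v → Adj G v (p v)
    adj-q : ∀ v → Adj G v (q v)
    adj-pq : ∀ v → Adj G (p v) (q v)
    adj-o : ∀ v → Adj G v (o v)
    neighbours : ∀ v w → Adj G v w → w ≡ p v ⊎ w ≡ q v ⊎ w ≡ o v
    p≢q : ∀ v → p v ≢ q v
    p≢o : ∀ v → p v ≢ o v
    q≢o : ∀ v → q v ≢ o v
    ¬adj-po : ∀ v → ¬ Adj G (p v) (o v)
    ¬adj-qo : ∀ v → ¬ Adj G (q v) (o v)

triangleStructureOr4Cycle : ∀ {n} (G : Graph n) → Cubic G → ClawFree G →
  HasCycleOfLength G 4 ⊎ TriangleStructure G
triangleStructureOr4Cycle G cubic clawFree with someOrAll (localTriangleOr4Cycle G cubic clawFree)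
... | inj₁ c4 = inj₁ c4
... | inj₂ L = inj₂ (record
  { p = λ v → p (L v) ; q = λ v → q (L v) ; o = λ v → o (L v)
  ; adj-p = λ v → adj-p (L v) ; adj-q = λ v → adj-q (L v) ; adj-pq = λ v → adj-pq (L v)
  ; adj-o = λ v → adj-o (L v) ; neighbours = λ v → neighbours (L v)
  ; p≢q = λ v → p≢q (L v) ; p≢o = λ v → p≢o (L v) ; q≢o = λ v → q≢o (L v)
  ; ¬adj-po = λ v → ¬adj-po (L v) ; ¬adj-qo = λ v → ¬adj-qo (L v) })
  where open LocalTriangle

-- The triangle graph

-- Contracting them gives a cubic multigraph whose edges are the pairs {v, o v}.
module Triangles {n : ℕ} (G : Graph n) (T : TriangleStructure G) where
  open TriangleStructure T public
  open GraphFacts G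

  V = Fin n

  adjacentNeighbours : ∀ u a b → Adj G u a → Adj G u b → a ≢ b → Adj G a b →
    (a ≡ p u × b ≡ q u) ⊎ (a ≡ q u × b ≡ p u)
  adjacentNeighbours u a b ua ub a≢b ab with neighbours u a ua | neighbours u b ub
  ... | inj₁ x | inj₁ y = ⊥-elim (a≢b (trans x (Eq.sym y)))
  ... | inj₁ x | inj₂ (inj₁ y) = inj₁ (x , y)
  ... | inj₁ x | inj₂ (inj₂ y) = ⊥-elim (¬adj-po u (subst₂ (Adj G) x y ab))
  ... | inj₂ (inj₁ x) | inj₁ y = inj₂ (x , y)
  ... | inj₂ (inj₁ x) | inj₂ (inj₁ y) = ⊥-elim (a≢b (trans x (Eq.sym y)))
  ... | inj₂ (inj₁ x) | inj₂ (inj₂ y) = ⊥-elim (¬adj-qo u (subst₂ (Adj G) x y ab))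
  ... | inj₂ (inj₂ x) | inj₁ y = ⊥-elim (¬adj-po u (subst₂ (Adj G) y x (adj-sym ab)))
  ... | inj₂ (inj₂ x) | inj₂ (inj₁ y) = ⊥-elim (¬adj-qo u (subst₂ (Adj G) y x (adj-sym ab)))
  ... | inj₂ (inj₂ x) | inj₂ (inj₂ y) = ⊥-elim (a≢b (trans x (Eq.sym y)))

  SameTri : V → V → Set
  SameTri u v = v ≡ u ⊎ v ≡ p u ⊎ v ≡ q u

  sameTri? : ∀ u v → Dec (SameTri u v)
  sameTri? u v with v F.≟ u | v F.≟ p u | v F.≟ q u
  ... | yes e | _ | _ = yes (inj₁ e)
  ... | no _ | yes e | _ = yes (inj₂ (inj₁ e))
  ... | no _ | no _ | yes e = yes (inj₂ (inj₂ e))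
  ... | no a | no b | no c = no λ { (inj₁ e) → a e ; (inj₂ (inj₁ e)) → b e ; (inj₂ (inj₂ e)) → c e }

  triangle-of-p : ∀ v → (v ≡ p (p v) × q v ≡ q (p v)) ⊎ (v ≡ q (p v) × q v ≡ p (p v))
  triangle-of-p v = adjacentNeighbours (p v) v (q v) (adj-sym (adj-p v)) (adj-pq v) (adj⇒≢ (adj-q v)) (adj-q v)

  triangle-of-q : ∀ v → (v ≡ p (q v) × p v ≡ q (q v)) ⊎ (v ≡ q (q v) × p v ≡ p (q v))
  triangle-of-q v = adjacentNeighbours (q v) v (p v) (adj-sym (adj-q v)) (adj-sym (adj-pq v)) (adj⇒≢ (adj-p v)) (adj-p v)

  SameTri-refl : ∀ u → SameTri u u
  SameTri-refl u = inj₁ refl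

  SameTri-sym : ∀ {u v} → SameTri u v → SameTri v u
  SameTri-sym (inj₁ refl) = inj₁ refl
  SameTri-sym {u} (inj₂ (inj₁ refl)) with triangle-of-p u
  ... | inj₁ (e , _) = inj₂ (inj₁ e)
  ... | inj₂ (e , _) = inj₂ (inj₂ e)
  SameTri-sym {u} (inj₂ (inj₂ refl)) with triangle-of-q u
  ... | inj₁ (e , _) = inj₂ (inj₁ e)
  ... | inj₂ (e , _) = inj₂ (inj₂ e)

  SameTri-trans : ∀ {u v w} → SameTri u v → SameTri v w → SameTri u w
  SameTri-trans (inj₁ refl) s = s
  SameTri-trans {u} (inj₂ (inj₁ refl)) (inj₁ refl) = inj₂ (inj₁ refl)
  SameTri-trans {u} (inj₂ (inj₁ refl)) (inj₂ (inj₁ refl)) with triangle-of-p u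
  ... | inj₁ (a , b) = inj₁ (Eq.sym a)
  ... | inj₂ (a , b) = inj₂ (inj₂ (Eq.sym b))
  SameTri-trans {u} (inj₂ (inj₁ refl)) (inj₂ (inj₂ refl)) with triangle-of-p u
  ... | inj₁ (a , b) = inj₂ (inj₂ (Eq.sym b))
  ... | inj₂ (a , b) = inj₁ (Eq.sym a)
  SameTri-trans {u} (inj₂ (inj₂ refl)) (inj₁ refl) = inj₂ (inj₂ refl)
  SameTri-trans {u} (inj₂ (inj₂ refl)) (inj₂ (inj₁ refl)) with triangle-of-q u
  ... | inj₁ (a , b) = inj₁ (Eq.sym a)
  ... | inj₂ (a , b) = inj₂ (inj₁ (Eq.sym b))
  SameTri-trans {u} (inj₂ (inj₂ refl)) (inj₂ (inj₂ refl)) with triangle-of-q u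
  ... | inj₁ (a , b) = inj₂ (inj₁ (Eq.sym b))
  ... | inj₂ (a , b) = inj₁ (Eq.sym a)

  ¬SameTri-o : ∀ v → ¬ SameTri v (o v)
  ¬SameTri-o v (inj₁ e) = adj⇒≢ (adj-o v) (Eq.sym e)
  ¬SameTri-o v (inj₂ (inj₁ e)) = p≢o v (Eq.sym e)
  ¬SameTri-o v (inj₂ (inj₂ e)) = q≢o v (Eq.sym e)

  SameTri-adj : ∀ {a b} → SameTri a b → a ≢ b → Adj G a b
  SameTri-adj (inj₁ e) a≢b = ⊥-elim (a≢b (Eq.sym e))
  SameTri-adj {a} (inj₂ (inj₁ refl)) _ = adj-p a
  SameTri-adj {a} (inj₂ (inj₂ refl)) _ = adj-q a

  ¬adj-o : ∀ v z → Adj G v z → ¬ Adj G z (o v)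
  ¬adj-o v z vz zo with neighbours v z vz
  ... | inj₁ refl = ¬adj-po v zo
  ... | inj₂ (inj₁ refl) = ¬adj-qo v zo
  ... | inj₂ (inj₂ refl) = adj⇒≢ zo refl

  o-involutive : ∀ v → o (o v) ≡ v
  o-involutive v with neighbours (o v) v (adj-sym (adj-o v))
  ... | inj₂ (inj₂ e) = Eq.sym e
  ... | inj₁ e = ⊥-elim (¬adj-o v (q (o v)) (subst (λ z → Adj G z (q (o v))) (Eq.sym e) (adj-pq (o v))) (adj-sym (adj-q (o v))))
  ... | inj₂ (inj₁ e) = ⊥-elim (¬adj-o v (p (o v)) (subst (λ z → Adj G z (p (o v))) (Eq.sym e) (adj-sym (adj-pq (o v)))) (adj-sym (adj-p (o v))))

  o-injective : ∀ {a b} → o a ≡ o b → a ≡ b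
  o-injective {a} {b} e = trans (Eq.sym (o-involutive a)) (trans (cong o e) (o-involutive b))

  -- Entering a triangle at e, we may leave it through one of the two exits p e, q e;
  -- the child is the entry of the neighbouring triangle reached that way.
  exit : V → Bool → V
  exit e true = p e
  exit e false = q e

  child : V → Bool → V
  child e b = o (exit e b)

  SameTri-exit : ∀ e b → SameTri e (exit e b)
  SameTri-exit e true = inj₂ (inj₁ refl)
  SameTri-exit e false = inj₂ (inj₂ refl)

  exit≢ : ∀ e b → exit e b ≢ e
  exit≢ e true x = adj⇒≢ (adj-p e) (Eq.sym x)
  exit≢ e false x = adj⇒≢ (adj-q e) (Eq.sym x)

  exit-injective : ∀ e a b → exit e a ≡ exit e b → a ≡ b
  exit-injective e true true _ = refl
  exit-injective e false false _ = refl
  exit-injective e true false x = ⊥-elim (p≢q e x)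
  exit-injective e false true x = ⊥-elim (p≢q e (Eq.sym x))

  -- A pass (a , b) through a triangle: entry a and exit b are distinct vertices of one triangle.
  Pass = V × V

  ValidPass : Pass → Set
  ValidPass (a , b) = a ≢ b × SameTri a b

  -- The remaining vertex of the triangle of a valid pass (a , b).
  third : V → V → V
  third a b with b F.≟ p a
  ... | yes _ = q a
  ... | no _ = p a

  third-valid : ∀ a b → ValidPass (a , b) → ValidPass (a , third a b) × ValidPass (third a b , b)
  third-valid a b (a≢b , s) with b F.≟ p a
  ... | yes e = ((λ x → adj⇒≢ (adj-q a) x) , inj₂ (inj₂ refl)) ,
                ((λ x → p≢q a (trans (Eq.sym e) (Eq.sym x))) , SameTri-trans (SameTri-sym (inj₂ (inj₂ refl))) s)
  ... | no b≢pa with s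
  ...   | inj₁ x = ⊥-elim (a≢b (Eq.sym x))
  ...   | inj₂ (inj₁ x) = ⊥-elim (b≢pa x)
  ...   | inj₂ (inj₂ x) = ((λ y → adj⇒≢ (adj-p a) y) , inj₂ (inj₁ refl)) ,
                          ((λ y → p≢q a (trans y x)) , SameTri-trans (SameTri-sym (inj₂ (inj₁ refl))) s)

  -- A route from s to t: valid passes, each entered from the previous exit along an o-edge.
  -- It is a walk in the triangle graph.
  Route : V → List Pass → V → Set
  Route s [] t = s ≡ t
  Route s ((a , b) ∷ vs) t = s ≡ a × ValidPass (a , b) × Route (o b) vs t

  Route-++ : ∀ {s t u} xs ys → Route s xs t → Route t ys u → Route s (xs ++ ys) u
  Route-++ [] ys refl c = c
  Route-++ ((a , b) ∷ xs) ys (e , ok , c) c₂ = e , ok , Route-++ xs ys c c₂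

  DistinctTriangles : Pass → Pass → Set
  DistinctTriangles u v = ¬ SameTri (proj₁ u) (proj₁ v)

  TriCycle : ℕ → Set
  TriCycle L = Σ (List Pass) λ vs → length vs ≡ L × Σ V (λ s → Route s vs s) × AllPairs DistinctTriangles vs

  -- A triangle cycle has length at least 2, since o-edges leave their triangle.
  noTriCycle1 : TriCycle 1 → ⊥
  noTriCycle1 (((a , b) ∷ []) , refl , (s , (refl , ok , e)) , _) =
    ¬SameTri-o b (subst (SameTri b) (Eq.sym e) (SameTri-sym (proj₂ ok)))

  -- Lifting a closed route to G: the first k passes also visit the third vertex of their triangle.
  liftList : List Pass → ℕ → List V
  liftList [] _ = []
  liftList ((a , b) ∷ vs) zero = a ∷ b ∷ liftList vs zero
  liftList ((a , b) ∷ vs) (suc k) = a ∷ third a b ∷ b ∷ liftList vs k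

  liftList-linked : ∀ {s t} vs k → Route s vs t →
    Σ (List V) λ rest → (liftList vs k ++ [ t ] ≡ s ∷ rest) × Linked (Adj G) (s ∷ rest)
  liftList-linked [] k refl = [] , refl , [-]
  liftList-linked ((a , b) ∷ vs) zero (refl , ok , c) with liftList-linked vs zero c
  ... | rest , e , lk = b ∷ o b ∷ rest , cong (λ z → a ∷ b ∷ z) e ,
        SameTri-adj (proj₂ ok) (proj₁ ok) ∷ (adj-o b ∷ lk)
  liftList-linked ((a , b) ∷ vs) (suc k) (refl , ok , c) with liftList-linked vs k c | third-valid a b ok
  ... | rest , e , lk | ok₁ , ok₂ = third a b ∷ b ∷ o b ∷ rest , cong (λ z → a ∷ third a b ∷ b ∷ z) e ,
        SameTri-adj (proj₂ ok₁) (proj₁ ok₁) ∷ (SameTri-adj (proj₂ ok₂) (proj₁ ok₂) ∷ (adj-o b ∷ lk))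

  liftList-avoids : ∀ {s t} a vs k → Route s vs t → All (λ v → ¬ SameTri a (proj₁ v)) vs →
    All (λ y → ¬ SameTri a y) (liftList vs k)
  liftList-avoids a [] k c al = []
  liftList-avoids a ((a' , b') ∷ vs) zero (refl , ok , c) (na ∷ al) =
    na ∷ (λ s → na (SameTri-trans s (SameTri-sym (proj₂ ok)))) ∷ liftList-avoids a vs zero c al
  liftList-avoids a ((a' , b') ∷ vs) (suc k) (refl , ok , c) (na ∷ al) =
    na ∷ (λ s → na (SameTri-trans s (SameTri-sym (proj₂ (proj₁ (third-valid a' b' ok)))))) ∷
    (λ s → na (SameTri-trans s (SameTri-sym (proj₂ ok)))) ∷ liftList-avoids a vs k c al

  ¬SameTri⇒≢ : ∀ {a} {ys : List V} → All (λ y → ¬ SameTri a y) ys → ∀ {x} → SameTri a x → All (x ≢_) ys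
  ¬SameTri⇒≢ [] s = []
  ¬SameTri⇒≢ (n ∷ ns) s = (λ { refl → n s }) ∷ ¬SameTri⇒≢ ns s

  liftList-distinct : ∀ {s t} vs k → Route s vs t → AllPairs DistinctTriangles vs → AllPairs _≢_ (liftList vs k)
  liftList-distinct [] k c d = []
  liftList-distinct ((a , b) ∷ vs) zero (refl , ok , c) (d ∷ ds) =
    (proj₁ ok ∷ ¬SameTri⇒≢ av (SameTri-refl a)) ∷ (¬SameTri⇒≢ av (proj₂ ok) ∷ liftList-distinct vs zero c ds)
    where av = liftList-avoids a vs zero c d
  liftList-distinct ((a , b) ∷ vs) (suc k) (refl , ok , c) (d ∷ ds) =
    (proj₁ ok₁ ∷ (proj₁ ok ∷ ¬SameTri⇒≢ av (SameTri-refl a))) ∷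
    ((proj₁ ok₂ ∷ ¬SameTri⇒≢ av (proj₂ ok₁)) ∷ (¬SameTri⇒≢ av (proj₂ ok) ∷ liftList-distinct vs k c ds))
    where
    av = liftList-avoids a vs k c d
    ok₁ = proj₁ (third-valid a b ok)
    ok₂ = proj₂ (third-valid a b ok)

  liftList-length : ∀ vs k → k ≤ length vs → length (liftList vs k) ≡ k + (length vs + length vs)
  liftList-length [] zero _ = refl
  liftList-length ((a , b) ∷ vs) zero z≤n =
    trans (cong (λ z → 2 + z) (liftList-length vs zero z≤n)) (twoPasses (length vs))
    where
    twoPasses : ∀ L → 2 + (L + L) ≡ suc L + suc L
    twoPasses = solve-∀
  liftList-length ((a , b) ∷ vs) (suc k) (s≤s k≤) =
    trans (cong (λ z → 3 + z) (liftList-length vs k k≤)) (threePasses k (length vs))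
    where
    threePasses : ∀ k L → 3 + (k + (L + L)) ≡ suc k + (suc L + suc L)
    threePasses = solve-∀

  liftCycle : ∀ {L} → TriCycle L → ∀ k → k ≤ L → 2 ≤ L → HasCycleOfLength G (k + (L + L))
  liftCycle ([] , refl , _) k k≤ ()
  liftCycle (vs@(_ ∷ _) , refl , (s , route) , distinct) k k≤ 2≤
    with liftList vs k | liftList-length vs k k≤ | liftList-linked vs k route | liftList-distinct vs k route distinct
  ... | [] | len | _ | _ = ⊥-elim (NP.0≢1+n (trans len (NP.+-suc k _)))
  ... | x₀ ∷ xs | len | rest , e , linked | distinct′ =
        subst (HasCycleOfLength G) len (cycleFromList G x₀ xs distinct′ closed (2≤xs (length xs) len))
    where
    s≡x₀ : s ≡ x₀
    s≡x₀ = LP.∷-injectiveˡ (Eq.sym e)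
    closed : Linked (Adj G) ((x₀ ∷ xs) ++ [ x₀ ])
    closed = subst (λ z → Linked (Adj G) ((x₀ ∷ xs) ++ [ z ])) s≡x₀ (subst (Linked (Adj G)) (Eq.sym e) linked)
    2≤xs : ∀ m → suc m ≡ k + (length vs + length vs) → 2 ≤ m
    2≤xs m eq = NP.≤-pred (NP.≤-trans (NP.n≤1+n 3)
      (NP.≤-trans (NP.+-mono-≤ 2≤ 2≤) (NP.≤-trans (NP.m≤n+m _ k) (NP.≤-reflexive (Eq.sym eq)))))

PowerOf2Cycle : ∀ {n} → Graph n → Set
PowerOf2Cycle G = Σ ℕ (λ k → IsPowerOf2 k × HasCycleOfLength G k)

-- Lengths L of triangle cycles whose lifts 2L, …, 3L include a power of two.
-- Among 1 … 8 only L = 5 (lifts 10 … 15) fails; L = 1 cannot occur.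
data Liftable : ℕ → Set where
  L2 : Liftable 2
  L3 : Liftable 3
  L4 : Liftable 4
  L6 : Liftable 6
  L7 : Liftable 7
  L8 : Liftable 8

module Lifting {n : ℕ} (G : Graph n) (T : TriangleStructure G) where
  open Triangles G T

  liftToPowerOf2 : ∀ {L} → TriCycle L → Liftable L → PowerOf2Cycle G
  liftToPowerOf2 c L2 = 4 , (2 , refl) , liftCycle c 0 z≤n (s≤s (s≤s z≤n))
  liftToPowerOf2 c L3 = 8 , (3 , refl) , liftCycle c 2 (s≤s (s≤s z≤n)) (s≤s (s≤s z≤n))
  liftToPowerOf2 c L4 = 8 , (3 , refl) , liftCycle c 0 z≤n (s≤s (s≤s z≤n))
  liftToPowerOf2 c L6 = 16 , (4 , refl) , liftCycle c 4 (s≤s (s≤s (s≤s (s≤s z≤n)))) (s≤s (s≤s z≤n))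
  liftToPowerOf2 c L7 = 16 , (4 , refl) , liftCycle c 2 (s≤s (s≤s z≤n)) (s≤s (s≤s z≤n))
  liftToPowerOf2 c L8 = 16 , (4 , refl) , liftCycle c 0 z≤n (s≤s (s≤s z≤n))

  liftableOr5 : ∀ {L} → TriCycle L → 1 ≤ L → L ≤ 8 → Liftable L ⊎ L ≡ 5
  liftableOr5 {1} c _ _ = ⊥-elim (noTriCycle1 c)
  liftableOr5 {2} c _ _ = inj₁ L2
  liftableOr5 {3} c _ _ = inj₁ L3
  liftableOr5 {4} c _ _ = inj₁ L4
  liftableOr5 {5} c _ _ = inj₂ refl
  liftableOr5 {6} c _ _ = inj₁ L6
  liftableOr5 {7} c _ _ = inj₁ L7
  liftableOr5 {8} c _ _ = inj₁ L8
  liftableOr5 {suc (suc (suc (suc (suc (suc (suc (suc (suc _))))))))} c _ (s≤s (s≤s (s≤s (s≤s (s≤s (s≤s (s≤s (s≤s ()))))))))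

  shortCycle : ∀ {L} → TriCycle L → 1 ≤ L → L ≤ 8 → PowerOf2Cycle G ⊎ TriCycle 5
  shortCycle c 1≤ ≤8 with liftableOr5 c 1≤ ≤8
  ... | inj₁ liftable = inj₁ (liftToPowerOf2 c liftable)
  ... | inj₂ refl = inj₂ c

  veryShortCycle : ∀ {L} → TriCycle L → 1 ≤ L → L ≤ 4 → PowerOf2Cycle G
  veryShortCycle c 1≤ ≤4 with liftableOr5 c 1≤ (NP.≤-trans ≤4 (NP.m≤m+n 4 4))
  ... | inj₁ liftable = liftToPowerOf2 c liftable
  ... | inj₂ refl = ⊥-elim (NP.<-irrefl refl ≤4)

  eitherLiftable : ∀ {L₁ L₂} → TriCycle L₁ → TriCycle L₂ → Liftable L₁ ⊎ Liftable L₂ → PowerOf2Cycle G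
  eitherLiftable c₁ c₂ (inj₁ l) = liftToPowerOf2 c₁ l
  eitherLiftable c₁ c₂ (inj₂ l) = liftToPowerOf2 c₂ l

-- Exploring the triangle graph from a triangle entered at e, each step picks one of the
-- two exits (true = p, false = q), so paths are addressed by lists of booleans.

compareAddresses : ∀ (α β : List Bool) → α ≢ β → length β ≤ length α →
  (Σ Bool λ a → Σ (List Bool) λ α' → α ≡ β ++ a ∷ α') ⊎
  (Σ (List Bool) λ γ → Σ Bool λ a → Σ Bool λ b → Σ (List Bool) λ α' → Σ (List Bool) λ β' →
     a ≢ b × α ≡ γ ++ a ∷ α' × β ≡ γ ++ b ∷ β')
compareAddresses [] [] α≢β _ = ⊥-elim (α≢β refl)
compareAddresses (a ∷ α) [] _ _ = inj₁ (a , α , refl)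
compareAddresses (a ∷ α) (b ∷ β) α≢β (s≤s β≤α) with a B.≟ b
... | no a≢b = inj₂ ([] , a , b , α , β , a≢b , refl , refl)
... | yes refl with compareAddresses α β (λ e → α≢β (cong (a ∷_) e)) β≤α
...   | inj₁ (a' , α' , e) = inj₁ (a' , α' , cong (a ∷_) e)
...   | inj₂ (γ , a' , b' , α' , β' , a'≢b' , e₁ , e₂) =
        inj₂ (a ∷ γ , a' , b' , α' , β' , a'≢b' , cong (a ∷_) e₁ , cong (a ∷_) e₂)

length-branch : ∀ (γ : List Bool) a δ → length (γ ++ a ∷ δ) ≡ length γ + suc (length δ)
length-branch γ a δ = LP.length-++ γ

branch-cancel : ∀ (γ : List Bool) {a δ δ'} → γ ++ a ∷ δ ≡ γ ++ a ∷ δ' → δ ≡ δ'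
branch-cancel γ e = LP.∷-injectiveʳ (LP.++-cancelˡ γ _ _ e)

branch-bit : ∀ (γ : List Bool) {a b δ δ'} → γ ++ a ∷ δ ≡ γ ++ b ∷ δ' → a ≡ b
branch-bit γ e = LP.∷-injectiveˡ (LP.++-cancelˡ γ _ _ e)

branch≢ : ∀ (β : List Bool) a δ → β ++ a ∷ δ ≢ β
branch≢ β a δ e = NP.m+1+n≢m (length β) (trans (Eq.sym (length-branch β a δ)) (cong length e))

branch-<-length : ∀ (β : List Bool) a δ α' → length δ < length α' → length (β ++ a ∷ δ) < length (β ++ a ∷ α')
branch-<-length β a δ α' l =
  subst₂ _<_ (Eq.sym (length-branch β a δ)) (Eq.sym (length-branch β a α')) (NP.+-monoʳ-< (length β) (s≤s l))

prefixes : ∀ {A : Set} → (List Bool → A) → List Bool → List A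
prefixes f [] = []
prefixes f (b ∷ α) = f [] ∷ prefixes (λ δ → f (b ∷ δ)) α

revPrefixes : ∀ {A : Set} → (List Bool → A) → List Bool → List A
revPrefixes f [] = []
revPrefixes f (b ∷ α) = revPrefixes (λ δ → f (b ∷ δ)) α ++ [ f [] ]

InRange : ∀ {A : Set} → (List Bool → A) → ℕ → A → Set
InRange f k a = Σ (List Bool) λ δ → a ≡ f δ × length δ < k

prefixes-range : ∀ {A : Set} (f : List Bool → A) α → All (InRange f (length α)) (prefixes f α)
prefixes-range f [] = []
prefixes-range f (b ∷ α) =
  ([] , refl , s≤s z≤n) ∷ All.map (λ { (δ , e , l) → (b ∷ δ) , e , s≤s l }) (prefixes-range _ α)

revPrefixes-range : ∀ {A : Set} (f : List Bool → A) α → All (InRange f (length α)) (revPrefixes f α)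
revPrefixes-range f [] = []
revPrefixes-range f (b ∷ α) =
  AllP.++⁺ (All.map (λ { (δ , e , l) → (b ∷ δ) , e , s≤s l }) (revPrefixes-range _ α)) (([] , refl , s≤s z≤n) ∷ [])

AddressInjective : ∀ {A : Set} → (List Bool → A) → Set
AddressInjective f = ∀ δ δ' → f δ ≡ f δ' → δ ≡ δ'

[]≢∷ : ∀ {b : Bool} {δ : List Bool} → [] ≢ b ∷ δ
[]≢∷ ()

prefixes-distinct : ∀ {A : Set} (f : List Bool → A) → AddressInjective f → ∀ α → AllPairs _≢_ (prefixes f α)
prefixes-distinct f f-inj [] = []
prefixes-distinct f f-inj (b ∷ α) =
  All.map (λ { (δ , refl , _) e → []≢∷ (f-inj _ _ e) }) (prefixes-range _ α) ∷
  prefixes-distinct _ (λ δ δ' e → LP.∷-injectiveʳ (f-inj _ _ e)) α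

revPrefixes-distinct : ∀ {A : Set} (f : List Bool → A) → AddressInjective f → ∀ α → AllPairs _≢_ (revPrefixes f α)
revPrefixes-distinct f f-inj [] = []
revPrefixes-distinct f f-inj (b ∷ α) =
  AP.++⁺ (revPrefixes-distinct _ (λ δ δ' e → LP.∷-injectiveʳ (f-inj _ _ e)) α) ([] ∷ [])
    (All.map (λ { (δ , refl , _) → (λ e → []≢∷ (Eq.sym (f-inj _ _ e))) ∷ [] }) (revPrefixes-range _ α))

allNe : ∀ {A : Set} {P : A → Set} {a : A} {ys : List A} → All P ys → (∀ y → P y → a ≢ y) → All (a ≢_) ys
allNe ps h = All.map (λ {y} → h y) ps

allWith : ∀ {A : Set} {P Q : A → Set} {ys : List A} → All P ys → (∀ y → P y → Q y) → All Q ys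
allWith ps h = All.map (λ {y} → h y) ps

-- The labels met by a cycle through two branches: the end f₂ β of the second branch, the
-- first branch upwards, the labels ks of the connecting route, and the second branch downwards.
branchLabels-distinct : ∀ {A : Set} (f₁ f₂ : List Bool → A) → AddressInjective f₁ → AddressInjective f₂ →
  (∀ δ δ' → f₁ δ ≢ f₂ δ') → ∀ ks → AllPairs _≢_ ks → (∀ δ → All (f₁ δ ≢_) ks) → All (λ k → ∀ δ → k ≢ f₂ δ) ks →
  ∀ α β → AllPairs _≢_ (f₂ β ∷ revPrefixes f₁ α ++ ks ++ prefixes f₂ β)
branchLabels-distinct f₁ f₂ f₁-inj f₂-inj f₁≢f₂ ks ks-distinct f₁∉ks ks∌f₂ α β =
  AllP.++⁺ (allNe (revPrefixes-range f₁ α) (λ { y (δ , refl , _) e → f₁≢f₂ δ β (Eq.sym e) }))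
    (AllP.++⁺ (All.map (λ k≢ e → k≢ β (Eq.sym e)) ks∌f₂)
      (allNe (prefixes-range f₂ β) (λ { y (δ , refl , l) e → NP.<⇒≢ l (Eq.sym (cong length (f₂-inj _ _ e))) }))) ∷
  AP.++⁺ (revPrefixes-distinct f₁ f₁-inj α)
    (AP.++⁺ ks-distinct (prefixes-distinct f₂ f₂-inj β)
      (All.map (λ k≢ → allNe (prefixes-range f₂ β) (λ { y (δ , refl , _) → k≢ δ })) ks∌f₂))
    (All.map (λ { (δ , refl , _) → AllP.++⁺ (f₁∉ks δ) (allNe (prefixes-range f₂ β) (λ { y (δ' , refl , _) → f₁≢f₂ δ δ' })) })
      (revPrefixes-range f₁ α))

module TreeWalks {n : ℕ} (G : Graph n) (T : TriangleStructure G) where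
  open Triangles G T

  walk : V → List Bool → V
  walk e [] = e
  walk e (b ∷ α) = walk (child e b) α

  walk-++ : ∀ e α β → walk e (α ++ β) ≡ walk (walk e α) β
  walk-++ e [] β = refl
  walk-++ e (b ∷ α) β = walk-++ (child e b) α β

  down : V → List Bool → List Pass
  down e [] = []
  down e (b ∷ α) = (e , exit e b) ∷ down (child e b) α

  up : V → List Bool → List Pass
  up e [] = []
  up e (b ∷ α) = up (child e b) α ++ [ (exit e b , e) ]

  Route-down : ∀ e α → Route e (down e α) (walk e α)
  Route-down e [] = refl
  Route-down e (b ∷ α) = refl , ((λ x → exit≢ e b (Eq.sym x)) , SameTri-exit e b) , Route-down (child e b) α

  Route-up : ∀ e α → Route (o (walk e α)) (up e α) (o e)
  Route-up e [] = refl
  Route-up e (b ∷ α) = Route-++ (up (child e b) α) [ (exit e b , e) ]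
    (subst (Route (o (walk (child e b) α)) (up (child e b) α)) (o-involutive (exit e b)) (Route-up (child e b) α))
    (refl , (exit≢ e b , SameTri-sym (SameTri-exit e b)) , refl)

  length-down : ∀ e α → length (down e α) ≡ length α
  length-down e [] = refl
  length-down e (b ∷ α) = cong suc (length-down (child e b) α)

  length-up : ∀ e α → length (up e α) ≡ length α
  length-up e [] = refl
  length-up e (b ∷ α) = trans (length-snoc (up (child e b) α) _) (cong suc (length-up (child e b) α))

  o-walk-snoc : ∀ e α b → o (walk e (α ++ [ b ])) ≡ exit (walk e α) b
  o-walk-snoc e α b = trans (cong o (walk-++ e α [ b ])) (o-involutive _)

-- The search explores triangles through labels of some type A; ent a is the entry vertex of the
-- triangle labelled a. Labels already explored are Avail, and distinct available labels are
-- separated: they name distinct triangles. A collision of a new label with an available one is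
-- turned into a short triangle cycle.
module Search {n : ℕ} (G : Graph n) (T : TriangleStructure G) {A : Set} (ent : A → Fin n) (Avail : A → Set)
  (separated : ∀ a b → Avail a → Avail b → a ≢ b → ¬ Triangles.SameTri G T (ent a) (ent b)) where
  open Triangles G T
  open TreeWalks G T

  LabelOf : Pass → A → Set
  LabelOf v a = SameTri (ent a) (proj₁ v)

  Labels : V → (List Bool → A) → Set
  Labels w f = ∀ δ → ent (f δ) ≡ walk w δ

  AvailBelow : (List Bool → A) → ℕ → Set
  AvailBelow f k = ∀ δ → length δ < k → Avail (f δ)

  Labels-branch : ∀ {w f} → Labels w f → ∀ γ a → Labels (child (walk w γ) a) (λ δ → f (γ ++ a ∷ δ))
  Labels-branch {w} hf γ a δ = trans (hf _) (walk-++ w γ (a ∷ δ))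

  label-exit : ∀ {w f} → Labels w f → ∀ δ b → SameTri (ent (f δ)) (exit (walk w δ) b)
  label-exit {w} hf δ b = subst (λ z → SameTri z (exit (walk w δ) b)) (Eq.sym (hf δ)) (SameTri-exit _ b)

  labels-down : ∀ (f : List Bool → A) w → Labels w f → ∀ α → Pointwise LabelOf (down w α) (prefixes f α)
  labels-down f w hf [] = []
  labels-down f w hf (b ∷ α) = inj₁ (Eq.sym (hf [])) ∷ labels-down _ (child w b) (λ δ → hf (b ∷ δ)) α

  labels-up : ∀ (f : List Bool → A) w → Labels w f → ∀ α → Pointwise LabelOf (up w α) (revPrefixes f α)
  labels-up f w hf [] = []
  labels-up f w hf (b ∷ α) = PW.++⁺ (labels-up _ (child w b) (λ δ → hf (b ∷ δ)) α) (label-exit hf [] b ∷ [])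

  distinctLabels⇒distinctTriangles : ∀ {vs as} → Pointwise LabelOf vs as → AllPairs _≢_ as → All Avail as →
    AllPairs DistinctTriangles vs
  distinctLabels⇒distinctTriangles [] [] [] = []
  distinctLabels⇒distinctTriangles {v ∷ _} {a ∷ _} (r ∷ rs) (d ∷ ds) (av ∷ avs) =
    separatedFrom v a r av rs d avs ∷ distinctLabels⇒distinctTriangles rs ds avs
    where
    separatedFrom : ∀ v a {vs as} → LabelOf v a → Avail a → Pointwise LabelOf vs as → All (a ≢_) as → All Avail as →
      All (DistinctTriangles v) vs
    separatedFrom v a r av [] [] [] = []
    separatedFrom v a r av (r' ∷ rs') (d' ∷ ds') (av' ∷ avs') =
      (λ s → separated _ _ av av' d' (SameTri-trans r (SameTri-trans s (SameTri-sym r')))) ∷ separatedFrom v a r av rs' ds' avs'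

  -- Two branches of trees, joined at their roots by the route K and at their ends by one pass
  -- between two vertices of a common triangle, form a triangle cycle.
  cycleThroughTwoBranches : ∀ (w₁ w₂ : V) (f₁ f₂ : List Bool → A) α β (K : List Pass) (ks : List A) (y : A) →
    Labels w₁ f₁ → Labels w₂ f₂ → Route (o w₁) K w₂ → Pointwise LabelOf K ks →
    SameTri (walk w₁ α) (walk w₂ β) → walk w₂ β ≢ walk w₁ α → SameTri (ent y) (walk w₂ β) →
    AllPairs _≢_ (y ∷ revPrefixes f₁ α ++ ks ++ prefixes f₂ β) → All Avail (y ∷ revPrefixes f₁ α ++ ks ++ prefixes f₂ β) →
    TriCycle (suc (length α + (length K + length β)))
  cycleThroughTwoBranches w₁ w₂ f₁ f₂ α β K ks y hf₁ hf₂ route routeLabels st ne sty distinct avail =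
    passes , len , (walk w₂ β , closed) , distinctLabels⇒distinctTriangles labels distinct avail
    where
    passes = (walk w₂ β , walk w₁ α) ∷ up w₁ α ++ K ++ down w₂ β
    len : length passes ≡ suc (length α + (length K + length β))
    len = cong suc (trans (LP.length-++ (up w₁ α))
            (cong₂ _+_ (length-up w₁ α) (trans (LP.length-++ K) (cong (length K +_) (length-down w₂ β)))))
    closed : Route (walk w₂ β) passes (walk w₂ β)
    closed = refl , (ne , SameTri-sym st) ,
             Route-++ (up w₁ α) (K ++ down w₂ β) (Route-up w₁ α) (Route-++ K (down w₂ β) route (Route-down w₂ β))
    labels : Pointwise LabelOf passes (y ∷ revPrefixes f₁ α ++ ks ++ prefixes f₂ β)
    labels = sty ∷ PW.++⁺ (labels-up f₁ w₁ hf₁ α) (PW.++⁺ routeLabels (labels-down f₂ w₂ hf₂ β))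

  branchLabels-avail : ∀ (f₁ f₂ : List Bool → A) α β ks → Avail (f₂ β) → AvailBelow f₁ (length α) → All Avail ks →
    AvailBelow f₂ (length β) → All Avail (f₂ β ∷ revPrefixes f₁ α ++ ks ++ prefixes f₂ β)
  branchLabels-avail f₁ f₂ α β ks avβ avs₁ avks avs₂ =
    avβ ∷ AllP.++⁺ (allWith (revPrefixes-range f₁ α) (λ { y (δ , refl , l) → avs₁ δ l }))
                   (AllP.++⁺ avks (allWith (prefixes-range f₂ β) (λ { y (δ , refl , l) → avs₂ δ l })))

  -- A route K₁ to the root of a tree, a branch down it, one pass out of its last triangle,
  -- and a route K₂ back form a triangle cycle.
  cycleThroughOneBranch : ∀ (s w z : V) (f : List Bool → A) α (K₁ K₂ : List Pass) (k₁s k₂s : List A) (y : A) →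
    Labels w f → Route s K₁ w → Route (o z) K₂ s → Pointwise LabelOf K₁ k₁s → Pointwise LabelOf K₂ k₂s →
    ValidPass (walk w α , z) → SameTri (ent y) (walk w α) →
    AllPairs _≢_ (k₁s ++ prefixes f α ++ y ∷ k₂s) → All Avail (k₁s ++ prefixes f α ++ y ∷ k₂s) →
    TriCycle (length K₁ + (length α + suc (length K₂)))
  cycleThroughOneBranch s w z f α K₁ K₂ k₁s k₂s y hf route₁ route₂ labels₁ labels₂ ok sty distinct avail =
    passes , len , (s , closed) , distinctLabels⇒distinctTriangles labels distinct avail
    where
    passes = K₁ ++ down w α ++ (walk w α , z) ∷ K₂
    len : length passes ≡ length K₁ + (length α + suc (length K₂))
    len = trans (LP.length-++ K₁)
            (cong (length K₁ +_) (trans (LP.length-++ (down w α)) (cong (_+ suc (length K₂)) (length-down w α))))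
    closed : Route s passes s
    closed = Route-++ K₁ _ route₁ (Route-++ (down w α) _ (Route-down w α) (refl , ok , route₂))
    labels : Pointwise LabelOf passes (k₁s ++ prefixes f α ++ y ∷ k₂s)
    labels = PW.++⁺ labels₁ (PW.++⁺ (labels-down f w hf α) (sty ∷ labels₂))

  lastStep : ∀ w α → (α ≡ [] × o (walk w α) ≡ o w) ⊎
    (Σ (List Bool) λ α'' → Σ Bool λ b → α ≡ α'' ++ [ b ] × o (walk w α) ≡ exit (walk w α'') b)
  lastStep w α with initLast α
  ... | [] = inj₁ (refl , refl)
  ... | α'' ∷ʳ′ b = inj₂ (α'' , b , refl , o-walk-snoc w α'' b)

  availBelow-snoc : ∀ (f : List Bool → A) (α'' : List Bool) b → AvailBelow f (length (α'' ++ [ b ])) →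
    ∀ δ → length δ ≤ length α'' → Avail (f δ)
  availBelow-snoc f α'' b avs δ l = avs δ (subst (length δ <_) (Eq.sym (length-snoc α'' b)) (s≤s l))

  walk≢entry : ∀ w (f : List Bool → A) → Labels w f → AddressInjective f →
    ∀ α → AvailBelow f (length α) → ∀ z → o z ≡ w → walk w α ≢ z
  walk≢entry w f hf f-inj α avs z oz e with lastStep w α
  ... | inj₁ (refl , _) = ¬SameTri-o z (inj₁ (trans oz e))
  ... | inj₂ (α'' , b , refl , oe) = backToRoot α'' b (trans (Eq.sym oe) (trans (cong o e) oz)) (availBelow-snoc f α'' b avs)
    where
    backToRoot : ∀ α'' b → exit (walk w α'') b ≡ w → (∀ δ → length δ ≤ length α'' → Avail (f δ)) → ⊥
    backToRoot [] b e _ = exit≢ w b e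
    backToRoot (x ∷ α'') b e av = separated (f (x ∷ α'')) (f []) (av _ NP.≤-refl) (av [] z≤n)
      (λ e₂ → []≢∷ (Eq.sym (f-inj _ _ e₂)))
      (subst₂ SameTri (Eq.sym (hf (x ∷ α''))) (Eq.sym (hf [])) (subst (SameTri (walk w (x ∷ α''))) e (SameTri-exit _ b)))

  walk≢outside : ∀ w (f : List Bool → A) → Labels w f →
    ∀ α → AvailBelow f (length α) → ∀ z → w ≢ z →
    ∀ a → Avail a → SameTri (ent a) (o z) → (∀ δ → f δ ≢ a) → walk w α ≢ z
  walk≢outside w f hf α avs z w≢z a av s f≢a e with lastStep w α
  ... | inj₁ (refl , _) = w≢z e
  ... | inj₂ (α'' , b , refl , oe) =
        separated (f α'') a (availBelow-snoc f α'' b avs α'' NP.≤-refl) av (f≢a α'')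
          (SameTri-trans (label-exit hf α'' b) (subst (λ z' → SameTri z' (ent a)) (trans (Eq.sym (cong o e)) oe) (SameTri-sym s)))

  walks-differ : ∀ w₁ w₂ (f₁ f₂ : List Bool → A) → Labels w₁ f₁ → Labels w₂ f₂ →
    ∀ α β → AvailBelow f₁ (length α) → AvailBelow f₂ (length β) →
    o w₁ ≢ o w₂ → ∀ a₁ a₂ → Avail a₁ → Avail a₂ → SameTri (ent a₁) (o w₁) → SameTri (ent a₂) (o w₂) →
    (∀ δ → a₁ ≢ f₂ δ) → (∀ δ → a₂ ≢ f₁ δ) → (∀ δ δ' → f₁ δ ≢ f₂ δ') →
    walk w₂ β ≢ walk w₁ α
  walks-differ w₁ w₂ f₁ f₂ hf₁ hf₂ α β av₁ av₂ o≢ a₁ a₂ ava₁ ava₂ s₁ s₂ n₁ n₂ n₁₂ e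
    with lastStep w₁ α | lastStep w₂ β
  ... | inj₁ (refl , _) | inj₁ (refl , _) = o≢ (cong o (Eq.sym e))
  ... | inj₁ (refl , _) | inj₂ (β'' , b₂ , refl , e₂) =
        separated a₁ (f₂ β'') ava₁ (availBelow-snoc f₂ β'' b₂ av₂ β'' NP.≤-refl) (n₁ β'')
          (SameTri-trans s₁ (subst (λ z → SameTri z (ent (f₂ β''))) (Eq.sym (trans (cong o (Eq.sym e)) e₂))
            (SameTri-sym (label-exit hf₂ β'' b₂))))
  ... | inj₂ (α'' , b₁ , refl , e₁) | inj₁ (refl , _) =
        separated a₂ (f₁ α'') ava₂ (availBelow-snoc f₁ α'' b₁ av₁ α'' NP.≤-refl) (n₂ α'')
          (SameTri-trans s₂ (subst (λ z → SameTri z (ent (f₁ α''))) (Eq.sym (trans (cong o e) e₁))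
            (SameTri-sym (label-exit hf₁ α'' b₁))))
  ... | inj₂ (α'' , b₁ , refl , e₁) | inj₂ (β'' , b₂ , refl , e₂) =
        separated (f₁ α'') (f₂ β'') (availBelow-snoc f₁ α'' b₁ av₁ α'' NP.≤-refl)
          (availBelow-snoc f₂ β'' b₂ av₂ β'' NP.≤-refl) (n₁₂ α'' β'')
          (SameTri-trans (label-exit hf₁ α'' b₁)
            (subst (λ z → SameTri z (ent (f₂ β''))) (Eq.sym (trans (Eq.sym e₁) (trans (cong o (Eq.sym e)) e₂)))
              (SameTri-sym (label-exit hf₂ β'' b₂))))

  returnCycle : ∀ w (f : List Bool → A) → Labels w f → AddressInjective f →
    ∀ α → AvailBelow f (length α) → ∀ z a → o z ≡ w → SameTri (ent a) z → SameTri (walk w α) (ent a) →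
    Avail a → (∀ δ → f δ ≢ a) → TriCycle (0 + (length α + 1))
  returnCycle w f hf f-inj α avs z a oz az st ava f≢a =
    cycleThroughOneBranch w w z f α [] [] [] [] a hf refl oz [] [] ok (SameTri-sym st) distinct avail
    where
    ok : ValidPass (walk w α , z)
    ok = walk≢entry w f hf f-inj α avs z oz , SameTri-trans st az
    distinct : AllPairs _≢_ ([] ++ prefixes f α ++ a ∷ [])
    distinct = AP.++⁺ (prefixes-distinct f f-inj α) ([] ∷ [])
      (All.map (λ { (δ , refl , _) → f≢a δ ∷ [] }) (prefixes-range f α))
    avail : All Avail ([] ++ prefixes f α ++ a ∷ [])
    avail = AllP.++⁺ (allWith (prefixes-range f α) (λ { y (δ , refl , l) → avs δ l })) (ava ∷ [])

  collisionWithPrefix : ∀ w (f : List Bool → A) → Labels w f → AddressInjective f →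
    ∀ β a α' → SameTri (walk w (β ++ a ∷ α')) (walk w β) → Avail (f β) → AvailBelow f (length (β ++ a ∷ α')) →
    TriCycle (0 + (length α' + 1))
  collisionWithPrefix w f hf f-inj β a α' st avβ avs =
    returnCycle (child c a) (λ δ → f (β ++ a ∷ δ)) (Labels-branch hf β a) (λ δ δ' e → branch-cancel β (f-inj _ _ e))
      α' (λ δ l → avs _ (branch-<-length β a δ α' l)) (exit c a) (f β) refl (label-exit hf β a)
      (subst₂ SameTri (walk-++ w β (a ∷ α')) (Eq.sym (hf β)) st) avβ (λ δ e → branch≢ β a δ (f-inj _ _ e))
    where
    c = walk w β

  collisionBranching : ∀ w (f : List Bool → A) → Labels w f → AddressInjective f →
    ∀ γ a b α' β' → a ≢ b → length (γ ++ b ∷ β') ≤ length (γ ++ a ∷ α') →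
    SameTri (walk w (γ ++ a ∷ α')) (walk w (γ ++ b ∷ β')) → Avail (f (γ ++ b ∷ β')) → AvailBelow f (length (γ ++ a ∷ α')) →
    TriCycle (suc (length α' + (1 + length β')))
  collisionBranching w f hf f-inj γ a b α' β' a≢b β≤α st avβ avs =
    cycleThroughTwoBranches w₁ w₂ f₁ f₂ α' β' [ (exit c a , exit c b) ] [ f γ ] (f (γ ++ b ∷ β')) hf₁ hf₂
      route (label-exit hf γ a ∷ []) st' ends≢ (inj₁ (Eq.sym (hf₂ β')))
      (branchLabels-distinct f₁ f₂ f₁-inj f₂-inj f₁≢f₂
        [ f γ ] ([] ∷ []) (λ δ → (λ e → fγ≢f₁ δ (Eq.sym e)) ∷ []) (fγ≢f₂ ∷ []) α' β')
      (branchLabels-avail f₁ f₂ α' β' [ f γ ] avβ avs₁ (avγ ∷ []) avs₂)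
    where
    c = walk w γ
    w₁ = child c a
    w₂ = child c b
    f₁ f₂ : List Bool → A
    f₁ δ = f (γ ++ a ∷ δ)
    f₂ δ = f (γ ++ b ∷ δ)
    hf₁ : Labels w₁ f₁
    hf₁ = Labels-branch hf γ a
    hf₂ : Labels w₂ f₂
    hf₂ = Labels-branch hf γ b
    f₁-inj : AddressInjective f₁
    f₁-inj δ δ' e = branch-cancel γ (f-inj _ _ e)
    f₂-inj : AddressInjective f₂
    f₂-inj δ δ' e = branch-cancel γ (f-inj _ _ e)
    f₁≢f₂ : ∀ δ δ' → f₁ δ ≢ f₂ δ'
    f₁≢f₂ δ δ' e = a≢b (branch-bit γ (f-inj _ _ e))
    fγ≢f₁ : ∀ δ → f γ ≢ f₁ δ
    fγ≢f₁ δ e = branch≢ γ a δ (Eq.sym (f-inj _ _ e))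
    fγ≢f₂ : ∀ δ → f γ ≢ f₂ δ
    fγ≢f₂ δ e = branch≢ γ b δ (Eq.sym (f-inj _ _ e))
    avs₁ : AvailBelow f₁ (length α')
    avs₁ δ l = avs _ (branch-<-length γ a δ α' l)
    avs₂ : AvailBelow f₂ (length β')
    avs₂ δ l = avs _ (NP.<-≤-trans (branch-<-length γ b δ β' l) β≤α)
    avγ : Avail (f γ)
    avγ = avs γ (subst (length γ <_) (Eq.sym (length-branch γ a α')) (NP.m<m+n (length γ) (s≤s z≤n)))
    st' : SameTri (walk w₁ α') (walk w₂ β')
    st' = subst₂ SameTri (walk-++ w γ (a ∷ α')) (walk-++ w γ (b ∷ β')) st
    route : Route (o w₁) [ (exit c a , exit c b) ] w₂
    route = o-involutive (exit c a) ,
            ((λ e → a≢b (exit-injective c a b e)) , SameTri-trans (SameTri-sym (SameTri-exit c a)) (SameTri-exit c b)) , refl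
    fromγ : ∀ x → SameTri (ent (f γ)) (o (child c x))
    fromγ x = subst (SameTri (ent (f γ))) (Eq.sym (o-involutive (exit c x))) (label-exit hf γ x)
    ends≢ : walk w₂ β' ≢ walk w₁ α'
    ends≢ = walks-differ w₁ w₂ f₁ f₂ hf₁ hf₂ α' β' avs₁ avs₂
      (λ e → a≢b (exit-injective c a b (trans (Eq.sym (o-involutive _)) (trans e (o-involutive _)))))
      (f γ) (f γ) avγ avγ (fromγ a) (fromγ b) fγ≢f₂ fγ≢f₁ f₁≢f₂

  collisionInOneTree : ∀ w (f : List Bool → A) → Labels w f → AddressInjective f →
    ∀ α β → α ≢ β → length β ≤ length α → SameTri (walk w α) (walk w β) → Avail (f β) → AvailBelow f (length α) →
    Σ ℕ λ L → TriCycle L × L ≤ length α + length β × 1 ≤ L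
  collisionInOneTree w f hf f-inj α β α≢β β≤α st avβ avs with compareAddresses α β α≢β β≤α
  ... | inj₁ (a , α' , refl) =
        _ , collisionWithPrefix w f hf f-inj β a α' st avβ avs , length≤ , NP.m≤n+m 1 (length α')
    where
    length≤ : 0 + (length α' + 1) ≤ length (β ++ a ∷ α') + length β
    length≤ = NP.≤-trans (NP.≤-reflexive (NP.+-comm (length α') 1))
                (NP.≤-trans (NP.m≤n+m (suc (length α')) (length β))
                  (NP.≤-trans (NP.≤-reflexive (Eq.sym (length-branch β a α'))) (NP.m≤m+n _ (length β))))
  ... | inj₂ (γ , a , b , α' , β' , a≢b , refl , refl) =
        _ , collisionBranching w f hf f-inj γ a b α' β' a≢b β≤α st avβ avs , length≤ , s≤s z≤n
    where
    length≤ : suc (length α' + (1 + length β')) ≤ length (γ ++ a ∷ α') + length (γ ++ b ∷ β')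
    length≤ = subst₂ _≤_ refl (cong₂ _+_ (Eq.sym (length-branch γ a α')) (Eq.sym (length-branch γ b β')))
                (NP.+-mono-≤ (NP.m≤n+m (suc (length α')) (length γ)) (NP.m≤n+m (suc (length β')) (length γ)))

module Scan {n : ℕ} (G : Graph n) (T : TriangleStructure G) {A : Set} (_≟A_ : DecidableEquality A) (ent : A → Fin n) where
  open Triangles G T
  open GraphFacts G using (adj⇒≢)

  TriangleInjective : List A → Set
  TriangleInjective L = ∀ a b → a ∈ L → b ∈ L → a ≢ b → ¬ SameTri (ent a) (ent b)

  injective-snoc : ∀ E x → TriangleInjective E → (∀ y → y ∈ E → ¬ (y ≢ x × SameTri (ent x) (ent y))) →
    TriangleInjective (E ++ [ x ])
  injective-snoc E x inj h a b a∈ b∈ a≢b s with ∈-++⁻ E a∈ | ∈-++⁻ E b∈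
  ... | inj₁ a∈E | inj₁ b∈E = inj a b a∈E b∈E a≢b s
  ... | inj₁ a∈E | inj₂ (here refl) = h a a∈E (a≢b , SameTri-sym s)
  ... | inj₂ (here refl) | inj₁ b∈E = h b b∈E ((λ e → a≢b (Eq.sym e)) , s)
  ... | inj₂ (here refl) | inj₂ (here refl) = a≢b refl

  Collision : List A → List A → Set
  Collision E xs = Σ (List A) λ E' → Σ A λ x → Σ (List A) λ rest →
    xs ≡ E' ++ x ∷ rest × TriangleInjective (E ++ E') × Σ A λ y → y ∈ E ++ E' × y ≢ x × SameTri (ent x) (ent y)

  scan : ∀ E xs → TriangleInjective E → TriangleInjective (E ++ xs) ⊎ Collision E xs
  scan E [] inj = inj₁ (subst TriangleInjective (Eq.sym (LP.++-identityʳ E)) inj)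
  scan E (x ∷ xs) inj with any? clashes? E
    where
    clashes? : ∀ y → Dec (y ≢ x × SameTri (ent x) (ent y))
    clashes? y with y ≟A x | sameTri? (ent x) (ent y)
    ... | yes e | _ = no (λ c → proj₁ c e)
    ... | no y≢x | yes s = yes (y≢x , s)
    ... | no _ | no ¬s = no (λ c → ¬s (proj₂ c))
  ... | yes clash with find clash
  ...   | y , y∈ , y≢x , s =
          inj₂ ([] , x , xs , refl , subst TriangleInjective (Eq.sym (LP.++-identityʳ E)) inj ,
                y , subst (y ∈_) (Eq.sym (LP.++-identityʳ E)) y∈ , y≢x , s)
  scan E (x ∷ xs) inj | no ¬clash with scan (E ++ [ x ]) xs (injective-snoc E x inj (λ y y∈ c → ¬clash (lose y∈ c)))
  ... | inj₁ inj′ = inj₁ (subst TriangleInjective (LP.++-assoc E [ x ] xs) inj′)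
  ... | inj₂ (E' , x' , rest , e , inj′ , y , y∈ , y≢x' , s) =
        inj₂ (x ∷ E' , x' , rest , cong (x ∷_) e , subst TriangleInjective (LP.++-assoc E [ x ] E') inj′ ,
              y , subst (y ∈_) (LP.++-assoc E [ x ] E') y∈ , y≢x' , s)

  triangleOf : Fin n → List (Fin n)
  triangleOf e = e ∷ p e ∷ q e ∷ []

  distinct⇒separateTriangles : ∀ L → TriangleInjective L → AllPairs _≢_ L →
    AllPairs (λ a b → ¬ SameTri (ent a) (ent b)) L
  distinct⇒separateTriangles [] inj [] = []
  distinct⇒separateTriangles (a ∷ L) inj (d ∷ ds) =
    fromHead L (λ b m → there m) d ∷ distinct⇒separateTriangles L (λ a b a∈ b∈ → inj a b (there a∈) (there b∈)) ds
    where
    fromHead : ∀ L' → (∀ b → b ∈ L' → b ∈ a ∷ L) → All (a ≢_) L' → All (λ b → ¬ SameTri (ent a) (ent b)) L'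
    fromHead [] _ [] = []
    fromHead (b ∷ L') sub (a≢b ∷ a≢L') = inj a b (here refl) (sub b (here refl)) a≢b ∷ fromHead L' (λ c m → sub c (there m)) a≢L'

  triangles-distinct : ∀ (es : List (Fin n)) → AllPairs (λ a b → ¬ SameTri a b) es → AllPairs _≢_ (concatMap triangleOf es)
  triangles-distinct [] [] = []
  triangles-distinct (e ∷ es) (d ∷ ds) =
    (adj⇒≢ (adj-p e) ∷ (adj⇒≢ (adj-q e) ∷ later (inj₁ refl))) ∷
    ((p≢q e ∷ later (inj₂ (inj₁ refl))) ∷ (later (inj₂ (inj₂ refl)) ∷ triangles-distinct es ds))
    where
    members : ∀ e' {z} → z ∈ triangleOf e' → SameTri e' z
    members e' (here refl) = inj₁ refl
    members e' (there (here refl)) = inj₂ (inj₁ refl)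
    members e' (there (there (here refl))) = inj₂ (inj₂ refl)
    avoidsAll : ∀ es' → All (λ b → ¬ SameTri e b) es' → ∀ {z} → SameTri e z → All (z ≢_) (concatMap triangleOf es')
    avoidsAll [] [] s = []
    avoidsAll (e' ∷ es') (n' ∷ ns) s =
      AllP.++⁺ (All.tabulate (λ {w} w∈ eq → n' (SameTri-trans (subst (SameTri e) eq s) (SameTri-sym (members e' w∈)))))
               (avoidsAll es' ns s)
    later : ∀ {z} → SameTri e z → All (z ≢_) (concatMap triangleOf es)
    later s = avoidsAll es d s

  triangles-length : ∀ (es : List (Fin n)) → length (concatMap triangleOf es) ≡ length es * 3
  triangles-length [] = refl
  triangles-length (e ∷ es) = cong (λ z → suc (suc (suc z))) (triangles-length es)

  distinct-length≤ : ∀ (d : Fin n) xs → AllPairs _≢_ xs → length xs ≤ n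
  distinct-length≤ d xs u = FP.injective⇒≤ {f = λ i → nth d xs (toℕ i)}
    (λ {i} {j} e → FP.toℕ-injective (nth-injective d xs u (toℕ i) (toℕ j) (FP.toℕ<n i) (FP.toℕ<n j) e))

  countTriangles : ∀ L → TriangleInjective L → AllPairs _≢_ L → ∀ (d : Fin n) → length L * 3 ≤ n
  countTriangles L inj u d = subst (_≤ n) (trans (triangles-length (map ent L)) (cong (_* 3) (LP.length-map ent L)))
    (distinct-length≤ d _ (triangles-distinct (map ent L) (AP.map⁺ (distinct⇒separateTriangles L inj u))))

addresses : ℕ → List (List Bool)
addresses zero = [] ∷ []
addresses (suc d) = cartesianProductWith _∷_ (true ∷ false ∷ []) (addresses d)

addresses-length : ∀ d {α} → α ∈ addresses d → length α ≡ d
addresses-length zero (here refl) = refl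
addresses-length (suc d) α∈ with ∈-cartesianProductWith⁻ _∷_ (true ∷ false ∷ []) (addresses d) α∈
... | _ , α' , _ , α'∈ , refl = cong suc (addresses-length d α'∈)

addresses-complete : ∀ α → α ∈ addresses (length α)
addresses-complete [] = here refl
addresses-complete (true ∷ α) = ∈-cartesianProductWith⁺ _∷_ {xs = true ∷ false ∷ []} (here refl) (addresses-complete α)
addresses-complete (false ∷ α) = ∈-cartesianProductWith⁺ _∷_ {xs = true ∷ false ∷ []} (there (here refl)) (addresses-complete α)

-- Labels of a search ball: c centre triangles, and k binary trees of triangles hanging off them.
data Label (c k : ℕ) : Set where
  centre : Fin c → Label c k
  branch : Fin k → List Bool → Label c k

module _ {c k : ℕ} where

  centre-injective : ∀ {i j} → centre {c} {k} i ≡ centre j → i ≡ j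
  centre-injective refl = refl

  branch-injective₁ : ∀ {i j α β} → branch {c} {k} i α ≡ branch j β → i ≡ j
  branch-injective₁ refl = refl

  branch-injective₂ : ∀ {i j α β} → branch {c} {k} i α ≡ branch j β → α ≡ β
  branch-injective₂ refl = refl

  _≟L_ : DecidableEquality (Label c k)
  centre i ≟L centre j with i F.≟ j
  ... | yes refl = yes refl
  ... | no i≢j = no (λ e → i≢j (centre-injective e))
  centre _ ≟L branch _ _ = no (λ ())
  branch _ _ ≟L centre _ = no (λ ())
  branch i α ≟L branch j β with i F.≟ j | LP.≡-dec B._≟_ α β
  ... | yes refl | yes refl = yes refl
  ... | no i≢j | _ = no (λ e → i≢j (branch-injective₁ e))
  ... | _ | no α≢β = no (λ e → α≢β (branch-injective₂ e))

  -- The distance of the labelled triangle from the centre.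
  level : Label c k → ℕ
  level (centre _) = 0
  level (branch _ α) = suc (length α)

  atLevel : ℕ → List (Label c k)
  atLevel zero = map centre (allFin c)
  atLevel (suc d) = cartesianProductWith branch (allFin k) (addresses d)

  atLevel-level : ∀ m {a} → a ∈ atLevel m → level a ≡ m
  atLevel-level zero a∈ with ∈-map⁻ centre a∈
  ... | _ , _ , refl = refl
  atLevel-level (suc d) a∈ with ∈-cartesianProductWith⁻ branch (allFin k) (addresses d) a∈
  ... | _ , _ , _ , α∈ , refl = cong suc (addresses-length d α∈)

  atLevel-complete : ∀ a → a ∈ atLevel (level a)
  atLevel-complete (centre i) = ∈-map⁺ centre (∈-allFin i)
  atLevel-complete (branch i α) = ∈-cartesianProductWith⁺ branch (∈-allFin i) (addresses-complete α)

  below : ℕ → List (Label c k)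
  below zero = []
  below (suc m) = below m ++ atLevel m

  below-level : ∀ m {a} → a ∈ below m → level a < m
  below-level (suc m) a∈ with ∈-++⁻ (below m) a∈
  ... | inj₁ a∈below = NP.m<n⇒m<1+n (below-level m a∈below)
  ... | inj₂ a∈level = NP.≤-reflexive (cong suc (atLevel-level m a∈level))

  below-complete : ∀ m a → level a < m → a ∈ below m
  below-complete (suc m) a l with NP.m<1+n⇒m<n∨m≡n l
  ... | inj₁ l' = ∈-++⁺ˡ (below-complete m a l')
  ... | inj₂ refl = ∈-++⁺ʳ (below m) (atLevel-complete a)

module LevelSearch {n : ℕ} (G : Graph n) (T : TriangleStructure G) {c k : ℕ}
  (centreVertex : Fin c → Fin n) (treeRoot : Fin k → Fin n) where
  open Triangles G T
  open TreeWalks G T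

  ent : Label c k → Fin n
  ent (centre j) = centreVertex j
  ent (branch i α) = walk (treeRoot i) α

  open Scan G T _≟L_ ent public

  record Clash (m : ℕ) : Set where
    field
      explored : List (Label c k)
      separated : TriangleInjective (below m ++ explored)
      x y : Label c k
      level-x : level x ≡ m
      level-y : level y ≤ m
      y-explored : y ∈ below m ++ explored
      y≢x : y ≢ x
      same : SameTri (ent x) (ent y)

  clashOf : ∀ m → Collision (below m) (atLevel m) → Clash m
  clashOf m (E' , x , rest , split , sep , y , y∈ , y≢x , s) =
    record { explored = E' ; separated = sep ; x = x ; y = y ; level-x = level-x ; level-y = level-y
           ; y-explored = y∈ ; y≢x = y≢x ; same = s }
    where
    x∈ : x ∈ atLevel m
    x∈ = subst (x ∈_) (Eq.sym split) (∈-++⁺ʳ E' (here refl))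
    level-x : level x ≡ m
    level-x = atLevel-level m x∈
    level-y : level y ≤ m
    level-y with ∈-++⁻ (below m) y∈
    ... | inj₁ y∈below = NP.<⇒≤ (below-level m y∈below)
    ... | inj₂ y∈E' = NP.≤-reflexive (atLevel-level m (subst (y ∈_) (Eq.sym split) (∈-++⁺ˡ y∈E')))

  scanLevels : ∀ {R : Set} D → (∀ m → m < D → Clash m → R) → R ⊎ TriangleInjective (below D)
  scanLevels zero _ = inj₂ (λ a b ())
  scanLevels (suc D) handle with scanLevels D (λ m m<D → handle m (NP.m<n⇒m<1+n m<D))
  ... | inj₁ r = inj₁ r
  ... | inj₂ sep with scan (below D) (atLevel D) sep
  ...   | inj₁ sep′ = inj₂ sep′
  ...   | inj₂ collision = inj₁ (handle D NP.≤-refl (clashOf D collision))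

  module Explored (m : ℕ) (explored : List (Label c k)) (sep : TriangleInjective (below m ++ explored)) where
    Avail : Label c k → Set
    Avail a = a ∈ below m ++ explored

    open Search G T ent Avail sep public

    availBelow : ∀ a → level a < m → Avail a
    availBelow a l = ∈-++⁺ˡ (below-complete m a l)

    branchLabels : ∀ i → Labels (treeRoot i) (branch i)
    branchLabels i δ = refl

    branchInjective : ∀ i → AddressInjective (branch {c} {k} i)
    branchInjective i δ δ' e = branch-injective₂ e

    branchAvail : ∀ (i : Fin k) (α : List Bool) {ℓ} → suc ℓ ≤ m → length α ≤ ℓ → AvailBelow (branch i) (length α)
    branchAvail i α ≤m α≤ δ l = availBelow (branch i δ) (NP.<-≤-trans (s≤s (NP.<-≤-trans l α≤)) ≤m)

    centreAvail : ∀ j → 0 < m → Avail (centre j)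
    centreAvail j 0<m = availBelow (centre j) 0<m

    shorter : ∀ (α β : List Bool) → suc (length α) ≡ m → suc (length β) ≤ m → length β ≤ length α
    shorter α β lx ly = NP.≤-pred (subst (suc (length β) ≤_) (Eq.sym lx) ly)

-- The ball of radius 4 around one triangle

-- If the ball of radius 4 around a triangle contains no triangle cycle, it is a tree with
-- 1 + 3 + 6 + 12 + 24 = 46 triangles, impossible on fewer than 138 vertices. Otherwise the
-- first clash yields a triangle cycle of length at most 8, which lifts unless its length is 5.
module RootBall {n : ℕ} (G : Graph n) (T : TriangleStructure G) (r : Fin n) where
  open Triangles G T
  open TreeWalks G T
  open Lifting G T
  open GraphFacts G using (adj⇒≢)

  -- The three vertices of the root triangle; tree i is entered through the o-edge at rootExit i.
  rootExit : Fin 3 → Fin n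
  rootExit F.zero = p r
  rootExit (F.suc F.zero) = q r
  rootExit (F.suc (F.suc F.zero)) = r

  rootExit-same : ∀ i → SameTri r (rootExit i)
  rootExit-same F.zero = inj₂ (inj₁ refl)
  rootExit-same (F.suc F.zero) = inj₂ (inj₂ refl)
  rootExit-same (F.suc (F.suc F.zero)) = inj₁ refl

  rootExit-injective : ∀ i j → rootExit i ≡ rootExit j → i ≡ j
  rootExit-injective F.zero F.zero e = refl
  rootExit-injective F.zero (F.suc F.zero) e = ⊥-elim (p≢q r e)
  rootExit-injective F.zero (F.suc (F.suc F.zero)) e = ⊥-elim (adj⇒≢ (adj-p r) (Eq.sym e))
  rootExit-injective (F.suc F.zero) F.zero e = ⊥-elim (p≢q r (Eq.sym e))
  rootExit-injective (F.suc F.zero) (F.suc F.zero) e = refl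
  rootExit-injective (F.suc F.zero) (F.suc (F.suc F.zero)) e = ⊥-elim (adj⇒≢ (adj-q r) (Eq.sym e))
  rootExit-injective (F.suc (F.suc F.zero)) F.zero e = ⊥-elim (adj⇒≢ (adj-p r) e)
  rootExit-injective (F.suc (F.suc F.zero)) (F.suc F.zero) e = ⊥-elim (adj⇒≢ (adj-q r) e)
  rootExit-injective (F.suc (F.suc F.zero)) (F.suc (F.suc F.zero)) e = refl

  open LevelSearch G T {1} {3} (λ _ → r) (λ i → o (rootExit i))

  ShortCycle : Set
  ShortCycle = Σ ℕ λ L → TriCycle L × 1 ≤ L × L ≤ 8

  module AtClash {m : ℕ} (m≤4 : m ≤ 4) (clash : Clash m) where
    open Explored m (Clash.explored clash) (Clash.separated clash)

    depth≤3 : ∀ (α : List Bool) → suc (length α) ≡ m → length α ≤ 3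
    depth≤3 α lx = NP.≤-pred (subst (_≤ 4) (Eq.sym lx) m≤4)

    backToRoot : ∀ i α → suc (length α) ≡ m → SameTri (walk (o (rootExit i)) α) r → ShortCycle
    backToRoot i α lx s =
      _ , returnCycle (o (rootExit i)) (branch i) (branchLabels i) (branchInjective i) α
            (branchAvail i α (NP.≤-reflexive lx) NP.≤-refl) (rootExit i) (centre F.zero) refl (rootExit-same i) s
            (centreAvail F.zero (subst (0 <_) lx (s≤s z≤n))) (λ δ ())
        , NP.m≤n+m 1 (length α) , NP.≤-trans (NP.+-monoˡ-≤ 1 (depth≤3 α lx)) (NP.m≤m+n 4 4)

    acrossRoot : ∀ i j α β → i ≢ j → suc (length α) ≡ m → length β ≤ length α →
      Avail (branch j β) → SameTri (walk (o (rootExit i)) α) (walk (o (rootExit j)) β) → ShortCycle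
    acrossRoot i j α β i≢j lx β≤α avβ s =
      _ , cycleThroughTwoBranches w₁ w₂ (branch i) (branch j) α β [ (rootExit i , rootExit j) ] [ centre F.zero ]
            (branch j β) (branchLabels i) (branchLabels j) route (rootExit-same i ∷ []) s ends≢ (inj₁ refl)
            (branchLabels-distinct (branch i) (branch j) (branchInjective i) (branchInjective j) branches≢
               [ centre F.zero ] ([] ∷ []) (λ δ → (λ ()) ∷ []) ((λ δ ()) ∷ []) α β)
            (branchLabels-avail (branch i) (branch j) α β [ centre F.zero ] avβ avs₁ (avR ∷ []) avs₂)
        , s≤s z≤n , s≤s (NP.+-mono-≤ (depth≤3 α lx) (s≤s (NP.≤-trans β≤α (depth≤3 α lx))))
      where
      w₁ = o (rootExit i)
      w₂ = o (rootExit j)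
      avs₁ : AvailBelow (branch i) (length α)
      avs₁ = branchAvail i α (NP.≤-reflexive lx) NP.≤-refl
      avs₂ : AvailBelow (branch j) (length β)
      avs₂ = branchAvail j β (NP.≤-reflexive lx) β≤α
      avR : Avail (centre F.zero)
      avR = centreAvail F.zero (subst (0 <_) lx (s≤s z≤n))
      route : Route (o w₁) [ (rootExit i , rootExit j) ] w₂
      route = o-involutive (rootExit i) ,
              ((λ e → i≢j (rootExit-injective i j e)) , SameTri-trans (SameTri-sym (rootExit-same i)) (rootExit-same j)) , refl
      fromRoot : ∀ l → SameTri r (o (o (rootExit l)))
      fromRoot l = subst (SameTri r) (Eq.sym (o-involutive (rootExit l))) (rootExit-same l)
      branches≢ : ∀ δ δ' → branch {1} i δ ≢ branch j δ'
      branches≢ δ δ' e = i≢j (branch-injective₁ e)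
      ends≢ : walk w₂ β ≢ walk w₁ α
      ends≢ = walks-differ w₁ w₂ (branch i) (branch j) (branchLabels i) (branchLabels j) α β avs₁ avs₂
        (λ e → i≢j (rootExit-injective i j (o-injective (o-injective e)))) (centre F.zero) (centre F.zero) avR avR
        (fromRoot i) (fromRoot j) (λ δ ()) (λ δ ()) branches≢

    clashCycle : ShortCycle
    clashCycle = dispatch (Clash.x clash) (Clash.y clash) (Clash.level-x clash) (Clash.level-y clash)
                          (Clash.y-explored clash) (Clash.y≢x clash) (Clash.same clash)
      where
      dispatch : ∀ x y → level x ≡ m → level y ≤ m → Avail y → y ≢ x → SameTri (ent x) (ent y) → ShortCycle
      dispatch (centre F.zero) (centre F.zero) _ _ _ y≢x _ = ⊥-elim (y≢x refl)
      dispatch (centre _) (branch _ _) refl () _ _ _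
      dispatch (branch i α) (centre F.zero) lx _ _ _ s = backToRoot i α lx s
      dispatch (branch i α) (branch j β) lx ly avβ y≢x s with i F.≟ j
      ... | no i≢j = acrossRoot i j α β i≢j lx (shorter α β lx ly) avβ s
      ... | yes refl with collisionInOneTree (o (rootExit i)) (branch i) (branchLabels i) (branchInjective i) α β
                            (λ e → y≢x (cong (branch i) (Eq.sym e))) (shorter α β lx ly) s avβ
                            (branchAvail i α (NP.≤-reflexive lx) NP.≤-refl)
      ...   | L , cycle , L≤ , 1≤L =
              L , cycle , 1≤L ,
              NP.≤-trans L≤ (NP.≤-trans (NP.+-mono-≤ (depth≤3 α lx) (NP.≤-trans (shorter α β lx ly) (depth≤3 α lx))) (NP.m≤n+m 6 2))

  ball-distinct : AllPairs _≢_ (below {1} {3} 5)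
  ball-distinct = toWitness {a? = allPairs? (λ a b → ¬? (a ≟L b)) (below 5)} tt

  rootBall : n < 138 → PowerOf2Cycle G ⊎ TriCycle 5
  rootBall n<138 with scanLevels 5 (λ m m<5 clash → AtClash.clashCycle (NP.≤-pred m<5) clash)
  ... | inj₁ (L , cycle , 1≤L , L≤8) = shortCycle cycle 1≤L L≤8
  ... | inj₂ sep = ⊥-elim (NP.≤⇒≯ (countTriangles (below 5) sep ball-distinct r) n<138)

succ5 : Fin 5 → Fin 5
succ5 i = next i

pred5 : Fin 5 → Fin 5
pred5 F.zero = F.suc (F.suc (F.suc (F.suc F.zero)))
pred5 (F.suc F.zero) = F.zero
pred5 (F.suc (F.suc F.zero)) = F.suc F.zero
pred5 (F.suc (F.suc (F.suc F.zero))) = F.suc (F.suc F.zero)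
pred5 (F.suc (F.suc (F.suc (F.suc F.zero)))) = F.suc (F.suc (F.suc F.zero))

succ5-pred5 : ∀ i → succ5 (pred5 i) ≡ i
succ5-pred5 F.zero = refl
succ5-pred5 (F.suc F.zero) = refl
succ5-pred5 (F.suc (F.suc F.zero)) = refl
succ5-pred5 (F.suc (F.suc (F.suc F.zero))) = refl
succ5-pred5 (F.suc (F.suc (F.suc (F.suc F.zero)))) = refl

iter : (Fin 5 → Fin 5) → ℕ → Fin 5 → Fin 5
iter f zero i = i
iter f (suc t) i = iter f t (f i)

offset : ∀ a b → a ≢ b → Σ ℕ λ t → t ≤ 3 × b ≡ iter succ5 (suc t) a × b ≡ iter pred5 (suc (3 ∸ t)) a
offset F.zero F.zero ne = ⊥-elim (ne refl)
offset F.zero (F.suc F.zero) ne = 0 , z≤n , refl , refl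
offset F.zero (F.suc (F.suc F.zero)) ne = 1 , s≤s z≤n , refl , refl
offset F.zero (F.suc (F.suc (F.suc F.zero))) ne = 2 , s≤s (s≤s z≤n) , refl , refl
offset F.zero (F.suc (F.suc (F.suc (F.suc F.zero)))) ne = 3 , s≤s (s≤s (s≤s z≤n)) , refl , refl
offset (F.suc F.zero) F.zero ne = 3 , s≤s (s≤s (s≤s z≤n)) , refl , refl
offset (F.suc F.zero) (F.suc F.zero) ne = ⊥-elim (ne refl)
offset (F.suc F.zero) (F.suc (F.suc F.zero)) ne = 0 , z≤n , refl , refl
offset (F.suc F.zero) (F.suc (F.suc (F.suc F.zero))) ne = 1 , s≤s z≤n , refl , refl
offset (F.suc F.zero) (F.suc (F.suc (F.suc (F.suc F.zero)))) ne = 2 , s≤s (s≤s z≤n) , refl , refl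
offset (F.suc (F.suc F.zero)) F.zero ne = 2 , s≤s (s≤s z≤n) , refl , refl
offset (F.suc (F.suc F.zero)) (F.suc F.zero) ne = 3 , s≤s (s≤s (s≤s z≤n)) , refl , refl
offset (F.suc (F.suc F.zero)) (F.suc (F.suc F.zero)) ne = ⊥-elim (ne refl)
offset (F.suc (F.suc F.zero)) (F.suc (F.suc (F.suc F.zero))) ne = 0 , z≤n , refl , refl
offset (F.suc (F.suc F.zero)) (F.suc (F.suc (F.suc (F.suc F.zero)))) ne = 1 , s≤s z≤n , refl , refl
offset (F.suc (F.suc (F.suc F.zero))) F.zero ne = 1 , s≤s z≤n , refl , refl
offset (F.suc (F.suc (F.suc F.zero))) (F.suc F.zero) ne = 2 , s≤s (s≤s z≤n) , refl , refl
offset (F.suc (F.suc (F.suc F.zero))) (F.suc (F.suc F.zero)) ne = 3 , s≤s (s≤s (s≤s z≤n)) , refl , refl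
offset (F.suc (F.suc (F.suc F.zero))) (F.suc (F.suc (F.suc F.zero))) ne = ⊥-elim (ne refl)
offset (F.suc (F.suc (F.suc F.zero))) (F.suc (F.suc (F.suc (F.suc F.zero)))) ne = 0 , z≤n , refl , refl
offset (F.suc (F.suc (F.suc (F.suc F.zero)))) F.zero ne = 0 , z≤n , refl , refl
offset (F.suc (F.suc (F.suc (F.suc F.zero)))) (F.suc F.zero) ne = 1 , s≤s z≤n , refl , refl
offset (F.suc (F.suc (F.suc (F.suc F.zero)))) (F.suc (F.suc F.zero)) ne = 2 , s≤s (s≤s z≤n) , refl , refl
offset (F.suc (F.suc (F.suc (F.suc F.zero)))) (F.suc (F.suc (F.suc F.zero))) ne = 3 , s≤s (s≤s (s≤s z≤n)) , refl , refl
offset (F.suc (F.suc (F.suc (F.suc F.zero)))) (F.suc (F.suc (F.suc (F.suc F.zero)))) ne = ⊥-elim (ne refl)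

orbit : (Fin 5 → Fin 5) → Fin 5 → ℕ → List (Fin 5)
orbit f i zero = []
orbit f i (suc t) = i ∷ orbit f (f i) t

orbit-snoc : ∀ f i t → orbit f i (suc t) ≡ orbit f i t ++ [ iter f t i ]
orbit-snoc f i zero = refl
orbit-snoc f i (suc t) = cong (i ∷_) (orbit-snoc f (f i) t)

orbit-take : ∀ f i t k → t ≤ k → orbit f i t ≡ take t (orbit f i k)
orbit-take f i zero k _ = refl
orbit-take f i (suc t) (suc k) (s≤s l) = cong (i ∷_) (orbit-take f (f i) t k l)

orbit-succ5-distinct : ∀ i → AllPairs _≢_ (orbit succ5 i 5)
orbit-succ5-distinct = toWitness {a? = FP.all? (λ i → allPairs? (λ a b → ¬? (a F.≟ b)) (orbit succ5 i 5))} tt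

orbit-pred5-distinct : ∀ i → AllPairs _≢_ (orbit pred5 i 5)
orbit-pred5-distinct = toWitness {a? = FP.all? (λ i → allPairs? (λ a b → ¬? (a F.≟ b)) (orbit pred5 i 5))} tt

-- A clash between branches of depth a, b ≤ 2 below triangles t + 1 steps apart
-- closes cycles of lengths a + b + t + 3 and a + b + (3 - t) + 3 around the two sides of the
-- 5-cycle; one of them is liftable.
crossLengths : ∀ a b t → a ≤ 2 → b ≤ 2 → t ≤ 3 →
  Liftable (suc (a + (suc (t + 1) + b))) ⊎ Liftable (suc (a + (suc ((3 ∸ t) + 1) + b)))
crossLengths 0 0 0 _ _ _ = inj₁ L3
crossLengths 0 0 1 _ _ _ = inj₁ L4
crossLengths 0 0 2 _ _ _ = inj₂ L4
crossLengths 0 0 3 _ _ _ = inj₁ L6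
crossLengths 0 1 0 _ _ _ = inj₁ L4
crossLengths 0 1 1 _ _ _ = inj₂ L6
crossLengths 0 1 2 _ _ _ = inj₁ L6
crossLengths 0 1 3 _ _ _ = inj₁ L7
crossLengths 0 2 0 _ _ _ = inj₂ L8
crossLengths 0 2 1 _ _ _ = inj₁ L6
crossLengths 0 2 2 _ _ _ = inj₁ L7
crossLengths 0 2 3 _ _ _ = inj₁ L8
crossLengths 1 0 0 _ _ _ = inj₁ L4
crossLengths 1 0 1 _ _ _ = inj₂ L6
crossLengths 1 0 2 _ _ _ = inj₁ L6
crossLengths 1 0 3 _ _ _ = inj₁ L7
crossLengths 1 1 0 _ _ _ = inj₂ L8
crossLengths 1 1 1 _ _ _ = inj₁ L6
crossLengths 1 1 2 _ _ _ = inj₁ L7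
crossLengths 1 1 3 _ _ _ = inj₁ L8
crossLengths 1 2 0 _ _ _ = inj₁ L6
crossLengths 1 2 1 _ _ _ = inj₁ L7
crossLengths 1 2 2 _ _ _ = inj₁ L8
crossLengths 1 2 3 _ _ _ = inj₂ L6
crossLengths 2 0 0 _ _ _ = inj₂ L8
crossLengths 2 0 1 _ _ _ = inj₁ L6
crossLengths 2 0 2 _ _ _ = inj₁ L7
crossLengths 2 0 3 _ _ _ = inj₁ L8
crossLengths 2 1 0 _ _ _ = inj₁ L6
crossLengths 2 1 1 _ _ _ = inj₁ L7
crossLengths 2 1 2 _ _ _ = inj₁ L8
crossLengths 2 1 3 _ _ _ = inj₂ L6
crossLengths 2 2 0 _ _ _ = inj₁ L7
crossLengths 2 2 1 _ _ _ = inj₁ L8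
crossLengths 2 2 2 _ _ _ = inj₂ L8
crossLengths 2 2 3 _ _ _ = inj₂ L7
crossLengths (suc (suc (suc a))) b t (s≤s (s≤s ())) _ _
crossLengths a (suc (suc (suc b))) t _ (s≤s (s≤s ())) _
crossLengths a b (suc (suc (suc (suc t)))) _ _ (s≤s (s≤s (s≤s ())))

-- A branch of depth a ≤ 2 returning to the 5-cycle t + 1 steps away closes cycles of lengths
-- a + t + 2 and a + (3 - t) + 2; one of them is liftable.
skeletonLengths : ∀ a t → a ≤ 2 → t ≤ 3 → Liftable (suc (a + suc t)) ⊎ Liftable (suc (a + suc (3 ∸ t)))
skeletonLengths 0 0 _ _ = inj₁ L2
skeletonLengths 0 1 _ _ = inj₁ L3
skeletonLengths 0 2 _ _ = inj₁ L4
skeletonLengths 0 3 _ _ = inj₂ L2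
skeletonLengths 1 0 _ _ = inj₁ L3
skeletonLengths 1 1 _ _ = inj₁ L4
skeletonLengths 1 2 _ _ = inj₂ L4
skeletonLengths 1 3 _ _ = inj₁ L6
skeletonLengths 2 0 _ _ = inj₁ L4
skeletonLengths 2 1 _ _ = inj₂ L6
skeletonLengths 2 2 _ _ = inj₁ L6
skeletonLengths 2 3 _ _ = inj₁ L7
skeletonLengths (suc (suc (suc a))) t (s≤s (s≤s ())) _
skeletonLengths a (suc (suc (suc (suc t)))) _ (s≤s (s≤s (s≤s ())))

allPairs-lookup : ∀ {A : Set} {R : A → A → Set} {xs : List A} → AllPairs R xs →
  ∀ {i j : Fin (length xs)} → i F.< j → R (lookup xs i) (lookup xs j)
allPairs-lookup (hd ∷ _) {F.zero} {F.suc j} _ = All.lookup hd (∈-lookup j)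
allPairs-lookup (_ ∷ tl) {F.suc i} {F.suc j} (s≤s i<j) = allPairs-lookup tl i<j

allPairs-snoc : ∀ {A : Set} {R : A → A → Set} xs (y : A) → AllPairs R (xs ++ [ y ]) → AllPairs R xs × All (λ x → R x y) xs
allPairs-snoc [] y _ = [] , []
allPairs-snoc (x ∷ xs) y (x~ ∷ rest) with allPairs-snoc xs y rest | AllP.++⁻ xs x~
... | rest′ , ~y | x~xs , (x~y ∷ []) = (x~xs ∷ rest′) , (x~y ∷ ~y)

module FiveCycle {n : ℕ} (G : Graph n) (T : TriangleStructure G) where
  open Triangles G T

  unpackFiveCycle : TriCycle 5 → Σ (Fin 5 → Fin n) λ E → Σ (Fin 5 → Fin n) λ X →
    (∀ i → ValidPass (E i , X i)) × (∀ i → o (X i) ≡ E (succ5 i)) × (∀ i j → i ≢ j → ¬ SameTri (E i) (E j))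
  unpackFiveCycle (passes@(_ ∷ _ ∷ _ ∷ _ ∷ _ ∷ []) , refl ,
                   (_ , (refl , valid₀ , (link₀ , valid₁ , (link₁ , valid₂ , (link₂ , valid₃ , (link₃ , valid₄ , link₄)))))) ,
                   distinct) =
    E , X , valid , link , distinctEntries
    where
    E X : Fin 5 → Fin n
    E i = proj₁ (lookup passes i)
    X i = proj₂ (lookup passes i)
    valid : ∀ i → ValidPass (E i , X i)
    valid F.zero = valid₀
    valid (F.suc F.zero) = valid₁
    valid (F.suc (F.suc F.zero)) = valid₂
    valid (F.suc (F.suc (F.suc F.zero))) = valid₃
    valid (F.suc (F.suc (F.suc (F.suc F.zero)))) = valid₄
    link : ∀ i → o (X i) ≡ E (succ5 i)
    link F.zero = link₀
    link (F.suc F.zero) = link₁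
    link (F.suc (F.suc F.zero)) = link₂
    link (F.suc (F.suc (F.suc F.zero))) = link₃
    link (F.suc (F.suc (F.suc (F.suc F.zero)))) = link₄
    distinctEntries : ∀ i j → i ≢ j → ¬ SameTri (E i) (E j)
    distinctEntries i j i≢j with FP.<-cmp i j
    ... | tri< i<j _ _ = allPairs-lookup distinct i<j
    ... | tri≈ _ i≡j _ = ⊥-elim (i≢j i≡j)
    ... | tri> _ _ j<i = λ s → allPairs-lookup distinct j<i (SameTri-sym s)

-- The ball of radius 3 around a triangle 5-cycle

-- Let C be a 5-cycle of triangles with entries E i and exits X i; tree i hangs off the third
-- vertex mid i of triangle i. If the ball of radius 3 around C contains no further cycle, it
-- holds 5 + 5 + 10 + 20 = 40 triangles, impossible on fewer than 120 vertices. Otherwise the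
-- first clash closes two cycles, going round either side of C, one of which lifts.
module FiveCycleBall {n : ℕ} (G : Graph n) (T : TriangleStructure G) (E X : Fin 5 → Fin n)
  (validEX : ∀ i → Triangles.ValidPass G T (E i , X i)) (link : ∀ i → TriangleStructure.o T (X i) ≡ E (succ5 i))
  (distinctEntries : ∀ i j → i ≢ j → ¬ Triangles.SameTri G T (E i) (E j)) where
  open Triangles G T
  open TreeWalks G T
  open Lifting G T

  mid : Fin 5 → Fin n
  mid i = third (E i) (X i)

  w : Fin 5 → Fin n
  w i = o (mid i)

  mid≢E : ∀ i → mid i ≢ E i
  mid≢E i e = proj₁ (proj₁ (third-valid (E i) (X i) (validEX i))) (Eq.sym e)

  mid≢X : ∀ i → mid i ≢ X i
  mid≢X i = proj₁ (proj₂ (third-valid (E i) (X i) (validEX i)))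

  sameTri-mid : ∀ i → SameTri (E i) (mid i)
  sameTri-mid i = proj₂ (proj₁ (third-valid (E i) (X i) (validEX i)))

  -- A direction of travel around C: entries E', exits X', and the next position step.
  record Orientation : Set where
    field
      E' X' : Fin 5 → Fin n
      step : Fin 5 → Fin 5
      valid' : ∀ i → ValidPass (E' i , X' i)
      link' : ∀ i → o (X' i) ≡ E' (step i)
      sameEntry : ∀ i → SameTri (E i) (E' i)
      mid≢E' : ∀ i → mid i ≢ E' i
      mid≢X' : ∀ i → mid i ≢ X' i
      orbit-distinct : ∀ i → AllPairs _≢_ (orbit step i 5)

  forward : Orientation
  forward = record { E' = E ; X' = X ; step = succ5 ; valid' = validEX ; link' = link ; sameEntry = λ i → inj₁ refl
                   ; mid≢E' = mid≢E ; mid≢X' = mid≢X ; orbit-distinct = orbit-succ5-distinct }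

  backward : Orientation
  backward = record
    { E' = X ; X' = E ; step = pred5
    ; valid' = λ i → (λ e → proj₁ (validEX i) (Eq.sym e)) , SameTri-sym (proj₂ (validEX i))
    ; link' = λ i → trans (cong o (Eq.sym (trans (link (pred5 i)) (cong E (succ5-pred5 i))))) (o-involutive (X (pred5 i)))
    ; sameEntry = λ i → proj₂ (validEX i) ; mid≢E' = mid≢X ; mid≢X' = mid≢E ; orbit-distinct = orbit-pred5-distinct }

  open LevelSearch G T {5} {5} E w

  module Arcs (O : Orientation) where
    open Orientation O

    arc : Fin 5 → ℕ → List Pass
    arc k zero = []
    arc k (suc t) = (E' k , X' k) ∷ arc (step k) t

    arc-route : ∀ k t → Route (E' k) (arc k t) (E' (iter step t k))
    arc-route k zero = refl
    arc-route k (suc t) = refl , valid' k ,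
      subst (λ z → Route z (arc (step k) t) (E' (iter step t (step k)))) (Eq.sym (link' k)) (arc-route (step k) t)

    arc-labels : ∀ k t → Pointwise (λ v a → SameTri (ent a) (proj₁ v)) (arc k t) (map centre (orbit step k t))
    arc-labels k zero = []
    arc-labels k (suc t) = sameEntry k ∷ arc-labels (step k) t

    arc-length : ∀ k t → length (arc k t) ≡ t
    arc-length k zero = refl
    arc-length k (suc t) = cong suc (arc-length (step k) t)

    distinctEntries' : ∀ i j → i ≢ j → ¬ SameTri (E' i) (E' j)
    distinctEntries' i j i≢j s = distinctEntries i j i≢j (SameTri-trans (sameEntry i) (SameTri-trans s (SameTri-sym (sameEntry j))))

    sameTri-mid' : ∀ i → SameTri (E' i) (mid i)
    sameTri-mid' i = SameTri-trans (SameTri-sym (sameEntry i)) (sameTri-mid i)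

    orbit-prefix-distinct : ∀ i t → t ≤ 5 → AllPairs _≢_ (orbit step i t)
    orbit-prefix-distinct i t l = subst (AllPairs _≢_) (Eq.sym (orbit-take step i t 5 l)) (AP.take⁺ t (orbit-distinct i))

    valid-entry-mid : ∀ j → ValidPass (E' j , mid j)
    valid-entry-mid j = (λ e → mid≢E' j (Eq.sym e)) , sameTri-mid' j

    valid-mid-exit : ∀ i → ValidPass (mid i , X' i)
    valid-mid-exit i = mid≢X' i , SameTri-trans (SameTri-sym (sameTri-mid' i)) (proj₂ (valid' i))

    root-exit-mid : ∀ i j → w i ≡ X' j → mid i ≡ E' (step j)
    root-exit-mid i j e = trans (Eq.sym (o-involutive (mid i))) (trans (cong o e) (link' j))

    root≢exit : ∀ i j → w i ≢ X' j
    root≢exit i j e with step j F.≟ i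
    ... | yes refl = mid≢E' i (root-exit-mid i j e)
    ... | no step≢ = distinctEntries' i (step j) (λ e′ → step≢ (Eq.sym e′)) (subst (SameTri (E' i)) (root-exit-mid i j e) (sameTri-mid' i))

    -- The route from the tree below i along C into the tree below j = step^{t+1} i: through the
    -- third vertex of triangle i, the t triangles strictly between, and triangle j from its entry.
    bridge : Fin 5 → Fin 5 → ℕ → List Pass
    bridge i j t = (mid i , X' i) ∷ (arc (step i) t ++ (E' j , mid j) ∷ [])

    bridgeTriangles : Fin 5 → Fin 5 → ℕ → List (Fin 5)
    bridgeTriangles i j t = i ∷ (orbit step (step i) t ++ j ∷ [])

    bridge-route : ∀ i j t → j ≡ iter step (suc t) i → Route (o (w i)) (bridge i j t) (w j)
    bridge-route i j t j≡ =
      o-involutive (mid i) , valid-mid-exit i ,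
      Route-++ (arc (step i) t) ((E' j , mid j) ∷ [])
        (subst (λ z → Route z (arc (step i) t) (E' (iter step t (step i)))) (Eq.sym (link' i)) (arc-route (step i) t))
        (cong E' (Eq.sym j≡) , valid-entry-mid j , refl)

    bridge-labels : ∀ i j t → Pointwise (λ v a → SameTri (ent a) (proj₁ v)) (bridge i j t) (map centre (bridgeTriangles i j t))
    bridge-labels i j t =
      sameTri-mid i ∷ subst (Pointwise _ (arc (step i) t ++ (E' j , mid j) ∷ [])) (Eq.sym (LP.map-++ centre (orbit step (step i) t) (j ∷ [])))
                            (PW.++⁺ (arc-labels (step i) t) (sameEntry j ∷ []))

    bridgeTriangles-distinct : ∀ i j t → j ≡ iter step (suc t) i → t ≤ 3 → AllPairs _≢_ (bridgeTriangles i j t)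
    bridgeTriangles-distinct i j t j≡ t≤3 = subst (AllPairs _≢_) (Eq.sym onOrbit) (orbit-prefix-distinct i (suc (suc t)) (s≤s (s≤s t≤3)))
      where
      onOrbit : bridgeTriangles i j t ≡ orbit step i (suc (suc t))
      onOrbit = cong (i ∷_) (trans (cong (λ z → orbit step (step i) t ++ z ∷ []) j≡) (Eq.sym (orbit-snoc step (step i) t)))

    bridge-length : ∀ i j t → length (bridge i j t) ≡ suc (t + 1)
    bridge-length i j t = cong suc (trans (LP.length-++ (arc (step i) t)) (cong (_+ 1) (arc-length (step i) t)))

  branch≢centres : ∀ i δ xs → All (branch {5} {5} i δ ≢_) (map centre xs)
  branch≢centres i δ [] = []
  branch≢centres i δ (x ∷ xs) = (λ ()) ∷ branch≢centres i δ xs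

  centre≢centres : ∀ i xs → All (_≢ i) xs → All (centre {5} {5} i ≢_) (map centre xs)
  centre≢centres i [] [] = []
  centre≢centres i (x ∷ xs) (x≢i ∷ xs≢i) = (λ e → x≢i (Eq.sym (centre-injective e))) ∷ centre≢centres i xs xs≢i

  centres-distinct : ∀ xs → AllPairs _≢_ xs → AllPairs _≢_ (map (centre {5} {5}) xs)
  centres-distinct xs u = AP.map⁺ (allPairs-map (λ x≢y e → x≢y (centre-injective e)) u)

  centres≢branch : ∀ j xs → All (λ a → ∀ δ → a ≢ branch {5} {5} j δ) (map centre xs)
  centres≢branch j [] = []
  centres≢branch j (x ∷ xs) = (λ δ ()) ∷ centres≢branch j xs

  module AtClash {m : ℕ} (m≤3 : m ≤ 3) (clash : Clash m) where
    open Explored m (Clash.explored clash) (Clash.separated clash)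

    centresAvail : ∀ xs → 0 < m → All Avail (map centre xs)
    centresAvail [] _ = []
    centresAvail (x ∷ xs) 0<m = centreAvail x 0<m ∷ centresAvail xs 0<m

    depth≤2 : ∀ (α : List Bool) → suc (length α) ≡ m → length α ≤ 2
    depth≤2 α lx = NP.≤-pred (subst (_≤ 3) (Eq.sym lx) m≤3)

    module Oriented (O : Orientation) where
      open Orientation O
      open Arcs O

      crossCycle : ∀ i j t → i ≢ j → j ≡ iter step (suc t) i → t ≤ 3 → ∀ α β → suc (length α) ≡ m → length β ≤ length α →
        Avail (branch j β) → SameTri (walk (w i) α) (walk (w j) β) → TriCycle (suc (length α + (suc (t + 1) + length β)))
      crossCycle i j t i≢j j≡ t≤3 α β lx β≤α avβ s =
        subst (λ z → TriCycle (suc (length α + (z + length β)))) (bridge-length i j t)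
          (cycleThroughTwoBranches (w i) (w j) (branch i) (branch j) α β (bridge i j t) ks (branch j β)
            (branchLabels i) (branchLabels j) (bridge-route i j t j≡) (bridge-labels i j t) s ends≢ (inj₁ refl)
            (branchLabels-distinct (branch i) (branch j) (branchInjective i) (branchInjective j) branches≢
               ks (centres-distinct _ (bridgeTriangles-distinct i j t j≡ t≤3))
               (λ δ → branch≢centres i δ (bridgeTriangles i j t)) (centres≢branch j (bridgeTriangles i j t)) α β)
            (branchLabels-avail (branch i) (branch j) α β ks avβ avs₁ (centresAvail (bridgeTriangles i j t) 0<m) avs₂))
        where
        ks = map centre (bridgeTriangles i j t)
        0<m : 0 < m
        0<m = subst (0 <_) lx (s≤s z≤n)
        avs₁ : AvailBelow (branch i) (length α)
        avs₁ = branchAvail i α (NP.≤-reflexive lx) NP.≤-refl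
        avs₂ : AvailBelow (branch j) (length β)
        avs₂ = branchAvail j β (NP.≤-reflexive lx) β≤α
        -- Distinct trees are entered from distinct triangles of C.
        o-roots≢ : o (w i) ≢ o (w j)
        o-roots≢ e = distinctEntries i j i≢j
          (SameTri-trans (sameTri-mid i) (subst (λ z → SameTri z (E j)) (Eq.sym (o-injective (o-injective e))) (SameTri-sym (sameTri-mid j))))
        fromCentre : ∀ l → SameTri (ent (centre l)) (o (w l))
        fromCentre l = subst (SameTri (E l)) (Eq.sym (o-involutive (mid l))) (sameTri-mid l)
        branches≢ : ∀ δ δ' → branch i δ ≢ branch j δ'
        branches≢ δ δ' e = i≢j (branch-injective₁ e)
        ends≢ : walk (w j) β ≢ walk (w i) α
        ends≢ = walks-differ (w i) (w j) (branch i) (branch j) (branchLabels i) (branchLabels j) α β avs₁ avs₂ o-roots≢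
          (centre i) (centre j) (centreAvail i 0<m) (centreAvail j 0<m) (fromCentre i) (fromCentre j) (λ δ ()) (λ δ ()) branches≢

      skeletonCycle : ∀ i j t → i ≢ j → i ≡ iter step (suc t) j → t ≤ 3 → ∀ α → suc (length α) ≡ m →
        SameTri (walk (w i) α) (E j) → TriCycle (suc (length α + suc t))
      skeletonCycle i j t i≢j i≡ t≤3 α lx s =
        subst (λ z → TriCycle (suc (length α + suc z))) (arc-length (step j) t)
          (cycleThroughOneBranch (E' i) (w i) (X' j) (branch i) α [ (E' i , mid i) ] (arc (step j) t)
            [ centre i ] (map centre (orbit step (step j) t)) (centre j) (branchLabels i)
            (refl , valid-entry-mid i , refl) back (sameEntry i ∷ []) (arc-labels (step j) t) valid (SameTri-sym s)
            distinct avail)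
        where
        js = j ∷ orbit step (step j) t
        0<m : 0 < m
        0<m = subst (0 <_) lx (s≤s z≤n)
        avs : AvailBelow (branch i) (length α)
        avs = branchAvail i α (NP.≤-reflexive lx) NP.≤-refl
        back : Route (o (X' j)) (arc (step j) t) (E' i)
        back = subst (λ z → Route z (arc (step j) t) (E' i)) (Eq.sym (link' j))
                 (subst (Route (E' (step j)) (arc (step j) t)) (cong E' (Eq.sym i≡)) (arc-route (step j) t))
        valid : ValidPass (walk (w i) α , X' j)
        valid = walk≢outside (w i) (branch i) (branchLabels i) α avs (X' j) (root≢exit i j) (centre (step j))
                  (centreAvail (step j) 0<m) (subst (SameTri (E (step j))) (Eq.sym (link' j)) (sameEntry (step j))) (λ δ ()) ,
                SameTri-trans s (SameTri-trans (sameEntry j) (proj₂ (valid' j)))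
        js-distinct : AllPairs _≢_ js × All (_≢ i) js
        js-distinct = allPairs-snoc js i (subst (AllPairs _≢_) onOrbit (orbit-prefix-distinct j (suc (suc t)) (s≤s (s≤s t≤3))))
          where
          onOrbit : orbit step j (suc (suc t)) ≡ js ++ i ∷ []
          onOrbit = trans (orbit-snoc step j (suc t)) (cong (λ z → js ++ z ∷ []) (Eq.sym i≡))
        distinct : AllPairs _≢_ ([ centre i ] ++ prefixes (branch i) α ++ map centre js)
        distinct =
          AllP.++⁺ (allNe (prefixes-range (branch i) α) (λ { y (δ , refl , _) () })) (centre≢centres i js (proj₂ js-distinct)) ∷
          AP.++⁺ (prefixes-distinct (branch i) (branchInjective i) α) (centres-distinct js (proj₁ js-distinct))
            (All.map (λ { (δ , refl , _) → branch≢centres i δ js }) (prefixes-range (branch i) α))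
        avail : All Avail ([ centre i ] ++ prefixes (branch i) α ++ map centre js)
        avail = centreAvail i 0<m ∷ AllP.++⁺ (allWith (prefixes-range (branch i) α) (λ { y (δ , refl , l) → avs δ l }))
                                             (centresAvail js 0<m)


    returnToCentre : ∀ i α → suc (length α) ≡ m → SameTri (walk (w i) α) (E i) → PowerOf2Cycle G
    returnToCentre i α lx s =
      veryShortCycle (returnCycle (w i) (branch i) (branchLabels i) (branchInjective i) α
                        (branchAvail i α (NP.≤-reflexive lx) NP.≤-refl) (mid i) (centre i) refl (sameTri-mid i) s
                        (centreAvail i (subst (0 <_) lx (s≤s z≤n))) (λ δ ()))
        (NP.m≤n+m 1 (length α)) (NP.+-monoˡ-≤ 1 (NP.≤-trans (depth≤2 α lx) (NP.n≤1+n 2)))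

    clashCycle : PowerOf2Cycle G
    clashCycle = dispatch (Clash.x clash) (Clash.y clash) (Clash.level-x clash) (Clash.level-y clash)
                          (Clash.y-explored clash) (Clash.y≢x clash) (Clash.same clash)
      where
      dispatch : ∀ x y → level x ≡ m → level y ≤ m → Avail y → y ≢ x → SameTri (ent x) (ent y) → PowerOf2Cycle G
      dispatch (centre i) (centre j) _ _ _ y≢x s = ⊥-elim (distinctEntries i j (λ e → y≢x (cong centre (Eq.sym e))) s)
      dispatch (centre _) (branch _ _) refl () _ _ _
      dispatch (branch i α) (centre j) lx _ _ _ s with j F.≟ i
      ... | yes refl = returnToCentre i α lx s
      ... | no j≢i with offset j i j≢i
      ...   | t , t≤3 , forwards , backwards =
              eitherLiftable (Oriented.skeletonCycle forward i j t (λ e → j≢i (Eq.sym e)) forwards t≤3 α lx s)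
                             (Oriented.skeletonCycle backward i j (3 ∸ t) (λ e → j≢i (Eq.sym e)) backwards (NP.m∸n≤m 3 t) α lx s)
                             (skeletonLengths (length α) t (depth≤2 α lx) t≤3)
      dispatch (branch i α) (branch j β) lx ly avβ y≢x s with i F.≟ j
      ... | yes refl with collisionInOneTree (w i) (branch i) (branchLabels i) (branchInjective i) α β
                            (λ e → y≢x (cong (branch i) (Eq.sym e))) (shorter α β lx ly) s avβ
                            (branchAvail i α (NP.≤-reflexive lx) NP.≤-refl)
      ...   | L , cycle , L≤ , 1≤L =
              veryShortCycle cycle 1≤L (NP.≤-trans L≤ (NP.+-mono-≤ (depth≤2 α lx) (NP.≤-trans (shorter α β lx ly) (depth≤2 α lx))))
      dispatch (branch i α) (branch j β) lx ly avβ y≢x s | no i≢j with offset i j i≢j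
      ... | t , t≤3 , forwards , backwards =
            eitherLiftable (Oriented.crossCycle forward i j t i≢j forwards t≤3 α β lx (shorter α β lx ly) avβ s)
                           (Oriented.crossCycle backward i j (3 ∸ t) i≢j backwards (NP.m∸n≤m 3 t) α β lx (shorter α β lx ly) avβ s)
                           (crossLengths (length α) (length β) t (depth≤2 α lx) (NP.≤-trans (shorter α β lx ly) (depth≤2 α lx)) t≤3)

  ball-distinct : AllPairs _≢_ (below {5} {5} 4)
  ball-distinct = toWitness {a? = allPairs? (λ a b → ¬? (a ≟L b)) (below 4)} tt

  fiveCycleBall : n < 120 → PowerOf2Cycle G
  fiveCycleBall n<120 with scanLevels 4 (λ m m<4 clash → AtClash.clashCycle (NP.≤-pred m<4) clash)
  ... | inj₁ cycle = cycle
  ... | inj₂ sep = ⊥-elim (NP.≤⇒≯ (countTriangles (below 4) sep ball-distinct (E F.zero)) n<120)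

fiveCycleCase : ∀ {n} (G : Graph n) (T : TriangleStructure G) → Triangles.TriCycle G T 5 → n < 120 → PowerOf2Cycle G
fiveCycleCase G T fiveCycle n<120 with FiveCycle.unpackFiveCycle G T fiveCycle
... | E , X , valid , link , distinct = FiveCycleBall.fiveCycleBall G T E X valid link distinct n<120

theorem9 : (n : ℕ) → (G : Graph n) → 0 < n → Cubic G → ClawFree G → n < 114 →
    Σ ℕ (λ k → IsPowerOf2 k × HasCycleOfLength G k)
theorem9 (suc n) G _ cubic clawFree n<114 with triangleStructureOr4Cycle G cubic clawFree
... | inj₁ fourCycle = 4 , (2 , refl) , fourCycle
... | inj₂ T with RootBall.rootBall G T F.zero (NP.<-≤-trans n<114 (NP.m≤m+n 114 24))
...   | inj₁ cycle = cycle
...   | inj₂ fiveCycle = fiveCycleCase G T fiveCycle (NP.<-≤-trans n<114 (NP.m≤m+n 114 6))
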